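{- Fix integers $k\ge1$, $x^*\ge0$ and real numbers $b_1,\ldots,b_k$. For $x=(x_1,\ldots,x_k)\in\{0,\ldots,x^*\}^k$ consider the polynomial in the variable $N$ $$P_x(N)=\sum_{i=1}^k\prod_{j=1}^k\prod_{h=x_j+1}^{x^*}(N-b_{j+i}+h)$$ (indices of $b$ mod $k$), of degree $L(x)=\sum_{j=1}^k(x^*-x_j)$. Then for every integer $m\ge0$ there exist finitely many functions $\sigma_1,\ldots,\sigma_R:\{0,\ldots,x^*\}^k\to\mathbb{R}$, each invariant under permutations of its $k$ arguments (depending on $k,x^*,b,m$), and functions $T_1,\ldots,T_R$, each either the constant function $1$ or a cyclic statistic of order between $1$ and $m$, such that for every $x\in\{0,\ldots,x^*\}^k$ the coefficient of $N^{L(x)-m}$ in $P_x(N)$ equals $\sum_{r=1}^R\sigma_r(x)\,T_r(x)$.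
   Context: Indices are interpreted mod $k$. A cyclic statistic of order $m$ of $x=(x_1,\ldots,x_k)$ is a function $S_{i_1,\ldots,i_m}(x)=\sum_{j=1}^k x_{i_1+j}\cdots x_{i_m+j}$ for some $(i_1,\ldots,i_m)\in\{1,\ldots,k\}^m$. -}

module Defs where

open import Level using (Level; _⊔_) renaming (suc to lsuc)
open import Algebra.Bundles using (CommutativeRing)
open import Relation.Binary.Structures using (IsTotalOrder)
open import Data.Nat as ℕ using (ℕ; zero; suc; _∸_; _≤?_; NonZero)
open import Data.Nat.DivMod using (_%_; m%n<n)
open import Data.Fin as F using (Fin; toℕ; fromℕ<)
open import Data.Fin.Permutation using (Permutation′; _⟨$⟩ʳ_)
open import Data.List using (List; []; _∷_; map)
open import Data.Product using (Σ; ∃; _×_; _,_)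
open import Relation.Nullary using (¬_; yes; no)

-- The real numbers, given axiomatically: a Dedekind-complete ordered
-- field.  (Classically every such structure is isomorphic to ℝ, so
-- quantifying over all of them is the same as speaking about ℝ.)

record RealField (c ℓ : Level) : Set (lsuc (c ⊔ ℓ)) where
  field
    commRing : CommutativeRing c ℓ
  open CommutativeRing commRing public
  field
    _≤_          : Carrier → Carrier → Set ℓ
    isTotalOrder : IsTotalOrder _≈_ _≤_
    nontrivial   : ¬ (0# ≈ 1#)
    inverse      : ∀ x → ¬ (x ≈ 0#) → ∃ λ y → x * y ≈ 1#
    +-mono-≤     : ∀ {x y} z → x ≤ y → (x + z) ≤ (y + z)
    *-nonneg     : ∀ {x y} → 0# ≤ x → 0# ≤ y → 0# ≤ (x * y)
    complete     : (P : Carrier → Set c) → ∃ P →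
                   (∃ λ u → ∀ x → P x → x ≤ u) →
                   ∃ λ s → (∀ x → P x → x ≤ s) ×
                           (∀ u → (∀ x → P x → x ≤ u) → s ≤ u)

module _ {c ℓ : Level} (ℝ : RealField c ℓ) where
  open RealField ℝ

  fromℕ : ℕ → Carrier
  fromℕ zero    = 0#
  fromℕ (suc n) = 1# + fromℕ n

  ∑ : (n : ℕ) → (Fin n → Carrier) → Carrier
  ∑ zero    f = 0#
  ∑ (suc n) f = f F.zero + ∑ n (λ i → f (F.suc i))

  ∏ : (n : ℕ) → (Fin n → Carrier) → Carrier
  ∏ zero    f = 1#
  ∏ (suc n) f = f F.zero * ∏ n (λ i → f (F.suc i))

  -- Polynomials in N with real coefficients, as coefficient lists
  -- (constant coefficient first).

  Poly : Set c
  Poly = List Carrier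

  _⊕_ : Poly → Poly → Poly
  []       ⊕ q        = q
  (a ∷ p)  ⊕ []       = a ∷ p
  (a ∷ p)  ⊕ (b ∷ q)  = (a + b) ∷ (p ⊕ q)

  linMul : Carrier → Poly → Poly
  linMul a p = map (a *_) p ⊕ (0# ∷ p)

  constOne : Poly
  constOne = 1# ∷ []

  prodLin : ℕ → (ℕ → Carrier) → Poly
  prodLin zero    g = constOne
  prodLin (suc n) g = linMul (g (suc n)) (prodLin n g)

  _⊗_ : Poly → Poly → Poly
  []      ⊗ q = []
  (a ∷ p) ⊗ q = map (a *_) q ⊕ (0# ∷ (p ⊗ q))

  ∏P : (n : ℕ) → (Fin n → Poly) → Poly
  ∏P zero    f = constOne
  ∏P (suc n) f = f F.zero ⊗ ∏P n (λ i → f (F.suc i))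

  ∑P : (n : ℕ) → (Fin n → Poly) → Poly
  ∑P zero    f = []
  ∑P (suc n) f = f F.zero ⊕ ∑P n (λ i → f (F.suc i))

  coeff : Poly → ℕ → Carrier
  coeff []      n       = 0#
  coeff (a ∷ p) zero    = a
  coeff (a ∷ p) (suc n) = coeff p n

  coeffDown : Poly → (L m : ℕ) → Carrier
  coeffDown p L m with m ≤? L
  ... | yes _ = coeff p (L ∸ m)
  ... | no  _ = 0#

_⊞_ : {k : ℕ} .{{_ : NonZero k}} → Fin k → Fin k → Fin k
_⊞_ {k} i j = fromℕ< (m%n<n (toℕ i ℕ.+ toℕ j) k)

module _ {c ℓ : Level} (ℝ : RealField c ℓ) where
  open RealField ℝ

  Config : (k xs : ℕ) → Set
  Config k xs = Fin k → Fin (suc xs)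

  val : {k xs : ℕ} → Config k xs → Fin k → Carrier
  val x j = fromℕ ℝ (toℕ (x j))

  P : (k xs : ℕ) .{{_ : NonZero k}} → (Fin k → Carrier) → Config k xs → Poly ℝ
  P k xs b x =
    ∑P ℝ k λ i → ∏P ℝ k λ j →
      prodLin ℝ (xs ∸ toℕ (x j)) λ t → (- b (j ⊞ i)) + fromℕ ℝ (toℕ (x j) ℕ.+ t)

  L : (k xs : ℕ) → Config k xs → ℕ
  L zero    xs x = 0
  L (suc k) xs x = (xs ∸ toℕ (x F.zero)) ℕ.+ L k xs (λ j → x (F.suc j))

  cyclicStat : {k xs : ℕ} .{{_ : NonZero k}} → (m : ℕ) → (Fin m → Fin k) →
               Config k xs → Carrier
  cyclicStat {k} m is x = ∑ ℝ k λ j → ∏ ℝ m λ t → val x (is t ⊞ j)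

  Symmetric : {k xs : ℕ} → (Config k xs → Carrier) → Set ℓ
  Symmetric {k} σ = ∀ (π : Permutation′ k) x → σ (λ j → x (π ⟨$⟩ʳ j)) ≈ σ x

data TSpec (k m : ℕ) : Set where
  one : TSpec k m
  cyc : (m' : ℕ) → 1 ℕ.≤ m' → m' ℕ.≤ m → (Fin m' → Fin k) → TSpec k m

module _ {c ℓ : Level} (ℝ : RealField c ℓ) where
  open RealField ℝ

  evalT : {k xs m : ℕ} .{{_ : NonZero k}} → TSpec k m → Config ℝ k xs → Carrier
  evalT one             x = 1#
  evalT (cyc m' _ _ is) x = cyclicStat ℝ m' is x

{-# OPTIONS --safe #-}
-- The coefficient of N^(L(x) - m) in P_x is ∑_i e_m(roots of the i-th product), e_m the
-- elementary symmetric function.  By Newton's identities m e_m = ∑_{r<m} ± e_{m-1-r} p_{r+1},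
-- p the power sums.  The power sum p_r of the i-th root list is ∑_j ∑_{h=x_j+1}^{x*} (h - b_{j+i})^r.
-- Write (h - β)^r = ff_r(h) + (falling factorials of lower degree, coefficients depending on β)
-- and telescope the sums over h: p_r becomes a symmetric function of x (coming from ff_r, whose
-- coefficient is β-free) plus terms ∑_j ψ(b_{j+i}) q(x_j) with deg q ≤ r.  By induction on m,
-- e_m is thus a finite sum of σ(x) ∑_j ψ(j+i) x_{d_1+j} ⋯ x_{d_n+j} with σ symmetric and n ≤ m;
-- degrees add under products, because re-indexing j turns the product of two such sums over j
-- into a sum over the relative shift of sums of the same kind.  Finally, summing over i turns
-- each of them into σ(x) (∑ψ) S_{d_1,…,d_n}(x), or into a symmetric function when n = 0.
module Submission where

open import Level using (Level; _⊔_)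
open import Defs
open import Algebra.Bundles using (CommutativeSemiring; CommutativeRing)
open import Data.Nat as ℕ using (ℕ; zero; suc)
import Data.Nat.Properties as ℕ
open import Data.Fin using (Fin)
open import Relation.Binary.PropositionalEquality as ≡ using (_≡_)
open import Relation.Nullary using (yes; no)

-- Algebra.Solver.Ring closes goals by computing normal forms, so its coefficients must
-- compute: the integers, mapped into R, serve for every commutative ring.
module RingSolver {c ℓ : Level} (R : CommutativeRing c ℓ) where
  open CommutativeRing R
  open import Algebra.Solver.Ring.AlmostCommutativeRing
    using (fromCommutativeRing; _-Raw-AlmostCommutative⟶_)
  import Algebra.Solver.Ring as Solver
  open import Data.Integer as ℤ using (ℤ; +_; -[1+_]; _⊖_)
  import Data.Integer.Properties as ℤ
  open import Data.Maybe using (Maybe; just; nothing)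
  open import Algebra.Properties.Ring ring
    using (-0#≈0#; -‿involutive; -‿+-comm; -‿distribˡ-*; -‿distribʳ-*)
  open import Algebra.Properties.Semiring.Mult.TCOptimised semiring
    using (_×_; ×-homo-+; ×1-homo-*; 1+×)
  open import Relation.Binary.Reasoning.Setoid setoid

  private
    -- This _×_ has 1 × x = x definitionally, so the coefficient 1 evaluates to 1# itself.
    fromℤ : ℤ → Carrier
    fromℤ (+ n)      = n × 1#
    fromℤ -[1+ n ]   = - (suc n × 1#)

    [z+x]-[z+y]≈x-y : ∀ x y z → (z + x) - (z + y) ≈ x - y
    [z+x]-[z+y]≈x-y x y z = begin
      (z + x) - (z + y)     ≈⟨ +-congˡ (sym (-‿+-comm z y)) ⟩
      (z + x) + (- z - y)   ≈⟨ +-congʳ (+-comm z x) ⟩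
      (x + z) + (- z - y)   ≈⟨ +-assoc x z (- z - y) ⟩
      x + (z + (- z - y))   ≈⟨ +-congˡ (sym (+-assoc z (- z) (- y))) ⟩
      x + ((z - z) - y)     ≈⟨ +-congˡ (+-congʳ (-‿inverseʳ z)) ⟩
      x + (0# - y)          ≈⟨ +-congˡ (+-identityˡ (- y)) ⟩
      x - y                 ∎

    ⊖-homo : ∀ m n → fromℤ (m ⊖ n) ≈ m × 1# - n × 1#
    ⊖-homo zero    zero    = sym (-‿inverseʳ 0#)
    ⊖-homo (suc m) zero    = sym (trans (+-congˡ -0#≈0#) (+-identityʳ _))
    ⊖-homo zero    (suc n) = sym (+-identityˡ _)
    ⊖-homo (suc m) (suc n) = begin
      fromℤ (suc m ⊖ suc n)           ≡⟨ ≡.cong fromℤ (ℤ.[1+m]⊖[1+n]≡m⊖n m n) ⟩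
      fromℤ (m ⊖ n)                   ≈⟨ ⊖-homo m n ⟩
      m × 1# - n × 1#                 ≈⟨ sym ([z+x]-[z+y]≈x-y _ _ 1#) ⟩
      (1# + m × 1#) - (1# + n × 1#)   ≈⟨ sym (+-cong (1+× m 1#) (-‿cong (1+× n 1#))) ⟩
      suc m × 1# - suc n × 1#         ∎

    neg-homo : ∀ i → fromℤ (ℤ.- i) ≈ - fromℤ i
    neg-homo (+ zero)  = sym -0#≈0#
    neg-homo (+ suc n) = refl
    neg-homo -[1+ n ]  = sym (-‿involutive _)

    +-homo : ∀ i j → fromℤ (i ℤ.+ j) ≈ fromℤ i + fromℤ j
    +-homo (+ m)    (+ n)    = ×-homo-+ 1# m n
    +-homo (+ m)    -[1+ n ] = ⊖-homo m (suc n)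
    +-homo -[1+ m ] (+ n)    = trans (⊖-homo n (suc m)) (+-comm _ _)
    +-homo -[1+ m ] -[1+ n ] = begin
      - (suc (suc (m ℕ.+ n)) × 1#)     ≡⟨ ≡.cong (λ k → - (suc k × 1#)) (≡.sym (ℕ.+-suc m n)) ⟩
      - ((suc m ℕ.+ suc n) × 1#)       ≈⟨ -‿cong (×-homo-+ 1# (suc m) (suc n)) ⟩
      - (suc m × 1# + suc n × 1#)      ≈⟨ sym (-‿+-comm _ _) ⟩
      - (suc m × 1#) - (suc n × 1#)    ∎

    *-homo : ∀ i j → fromℤ (i ℤ.* j) ≈ fromℤ i * fromℤ j
    *-homo (+ m)    (+ n)    = begin
      fromℤ (+ m ℤ.* + n)         ≡⟨ ≡.cong fromℤ (ℤ.+◃n≡+n (m ℕ.* n)) ⟩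
      (m ℕ.* n) × 1#              ≈⟨ ×1-homo-* m n ⟩
      m × 1# * n × 1#             ∎
    *-homo (+ m)    -[1+ n ] = begin
      fromℤ (+ m ℤ.* -[1+ n ])       ≡⟨ ≡.cong fromℤ (ℤ.-◃n≡-n (m ℕ.* suc n)) ⟩
      fromℤ (ℤ.- (+ (m ℕ.* suc n)))   ≈⟨ neg-homo (+ (m ℕ.* suc n)) ⟩
      - ((m ℕ.* suc n) × 1#)          ≈⟨ -‿cong (×1-homo-* m (suc n)) ⟩
      - (m × 1# * suc n × 1#)         ≈⟨ -‿distribʳ-* _ _ ⟩
      m × 1# * - (suc n × 1#)         ∎
    *-homo -[1+ m ] (+ n)    = begin
      fromℤ (-[1+ m ] ℤ.* + n)       ≡⟨ ≡.cong fromℤ (ℤ.-◃n≡-n (suc m ℕ.* n)) ⟩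
      fromℤ (ℤ.- (+ (suc m ℕ.* n)))   ≈⟨ neg-homo (+ (suc m ℕ.* n)) ⟩
      - ((suc m ℕ.* n) × 1#)          ≈⟨ -‿cong (×1-homo-* (suc m) n) ⟩
      - (suc m × 1# * n × 1#)         ≈⟨ -‿distribˡ-* _ _ ⟩
      - (suc m × 1#) * n × 1#         ∎
    *-homo -[1+ m ] -[1+ n ] = begin
      (suc m ℕ.* suc n) × 1#            ≈⟨ ×1-homo-* (suc m) (suc n) ⟩
      suc m × 1# * suc n × 1#           ≈⟨ sym (-‿involutive _) ⟩
      - - (suc m × 1# * suc n × 1#)     ≈⟨ -‿cong (-‿distribˡ-* _ _) ⟩
      - (- (suc m × 1#) * suc n × 1#)   ≈⟨ -‿distribʳ-* _ _ ⟩
      - (suc m × 1#) * - (suc n × 1#)   ∎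

    homomorphism : ℤ.+-*-rawRing -Raw-AlmostCommutative⟶ fromCommutativeRing R
    homomorphism = record
      { ⟦_⟧    = fromℤ
      ; +-homo = +-homo
      ; *-homo = *-homo
      ; -‿homo = neg-homo
      ; 0-homo = refl
      ; 1-homo = refl
      }

    fromℤ-≟ : ∀ i j → Maybe (fromℤ i ≈ fromℤ j)
    fromℤ-≟ i j with i ℤ.≟ j
    ... | yes i≡j = just (reflexive (≡.cong fromℤ i≡j))
    ... | no  _   = nothing

  open Solver ℤ.+-*-rawRing (fromCommutativeRing R) homomorphism fromℤ-≟ public
    using (solve; _:=_; _:+_; _:*_; :-_; _:-_; con)

module CyclicIndex (k' : ℕ) where
  open import Data.Fin using (toℕ; fromℕ<)
  open import Data.Fin.Properties using (toℕ-injective; toℕ-fromℕ<; toℕ<n)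
  open import Data.Fin.Permutation using (Permutation′; permutation)
  open import Data.Nat.DivMod using (_%_; m%n<n; m<n⇒m%n≡m; %-distribˡ-+; m%n%n≡m%n; [m+n]%n≡m%n)
  open ≡.≡-Reasoning

  private
    K : ℕ
    K = suc k'

  toℕ-⊞ : (i j : Fin K) → toℕ (i ⊞ j) ≡ (toℕ i ℕ.+ toℕ j) % K
  toℕ-⊞ i j = toℕ-fromℕ< _

  private
    %-absorbˡ : ∀ m n → (m % K ℕ.+ n) % K ≡ (m ℕ.+ n) % K
    %-absorbˡ m n = begin
      (m % K ℕ.+ n) % K           ≡⟨ %-distribˡ-+ (m % K) n K ⟩
      (m % K % K ℕ.+ n % K) % K   ≡⟨ ≡.cong (λ a → (a ℕ.+ n % K) % K) (m%n%n≡m%n m K) ⟩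
      (m % K ℕ.+ n % K) % K       ≡⟨ %-distribˡ-+ m n K ⟨
      (m ℕ.+ n) % K               ∎

    %-absorbʳ : ∀ m n → (m ℕ.+ n % K) % K ≡ (m ℕ.+ n) % K
    %-absorbʳ m n = begin
      (m ℕ.+ n % K) % K   ≡⟨ ≡.cong (_% K) (ℕ.+-comm m (n % K)) ⟩
      (n % K ℕ.+ m) % K   ≡⟨ %-absorbˡ n m ⟩
      (n ℕ.+ m) % K       ≡⟨ ≡.cong (_% K) (ℕ.+-comm n m) ⟩
      (m ℕ.+ n) % K       ∎

    toℕ-% : (i : Fin K) → toℕ i % K ≡ toℕ i
    toℕ-% i = m<n⇒m%n≡m (toℕ<n i)

  ⊞-assoc : (i j l : Fin K) → (i ⊞ j) ⊞ l ≡ i ⊞ (j ⊞ l)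
  ⊞-assoc i j l = toℕ-injective (begin
    toℕ ((i ⊞ j) ⊞ l)           ≡⟨ toℕ-⊞ (i ⊞ j) l ⟩
    (toℕ (i ⊞ j) ℕ.+ u) % K     ≡⟨ ≡.cong (λ v → (v ℕ.+ u) % K) (toℕ-⊞ i j) ⟩
    ((s ℕ.+ t) % K ℕ.+ u) % K   ≡⟨ %-absorbˡ (s ℕ.+ t) u ⟩
    (s ℕ.+ t ℕ.+ u) % K         ≡⟨ ≡.cong (_% K) (ℕ.+-assoc s t u) ⟩
    (s ℕ.+ (t ℕ.+ u)) % K       ≡⟨ %-absorbʳ s (t ℕ.+ u) ⟨
    (s ℕ.+ (t ℕ.+ u) % K) % K   ≡⟨ ≡.cong (λ v → (s ℕ.+ v) % K) (toℕ-⊞ j l) ⟨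
    (s ℕ.+ toℕ (j ⊞ l)) % K     ≡⟨ toℕ-⊞ i (j ⊞ l) ⟨
    toℕ (i ⊞ (j ⊞ l))           ∎)
    where
    s t u : ℕ
    s = toℕ i
    t = toℕ j
    u = toℕ l

  ⊞-comm : (i j : Fin K) → i ⊞ j ≡ j ⊞ i
  ⊞-comm i j = toℕ-injective (begin
    toℕ (i ⊞ j)               ≡⟨ toℕ-⊞ i j ⟩
    (toℕ i ℕ.+ toℕ j) % K     ≡⟨ ≡.cong (_% K) (ℕ.+-comm (toℕ i) (toℕ j)) ⟩
    (toℕ j ℕ.+ toℕ i) % K     ≡⟨ toℕ-⊞ j i ⟨
    toℕ (j ⊞ i)               ∎)

  ⊞-identityˡ : (j : Fin K) → Fin.zero ⊞ j ≡ j
  ⊞-identityˡ j = toℕ-injective (≡.trans (toℕ-⊞ Fin.zero j) (toℕ-% j))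

  ⊟ : Fin K → Fin K
  ⊟ d = fromℕ< (m%n<n (K ℕ.∸ toℕ d) K)

  ⊞-inverseʳ : (d : Fin K) → d ⊞ ⊟ d ≡ Fin.zero
  ⊞-inverseʳ d = toℕ-injective (begin
    toℕ (d ⊞ ⊟ d)                           ≡⟨ toℕ-⊞ d (⊟ d) ⟩
    (toℕ d ℕ.+ toℕ (⊟ d)) % K                ≡⟨ ≡.cong (λ a → (toℕ d ℕ.+ a) % K) (toℕ-fromℕ< _) ⟩
    (toℕ d ℕ.+ (K ℕ.∸ toℕ d) % K) % K        ≡⟨ %-absorbʳ (toℕ d) (K ℕ.∸ toℕ d) ⟩
    (toℕ d ℕ.+ (K ℕ.∸ toℕ d)) % K            ≡⟨ ≡.cong (_% K) (ℕ.m+[n∸m]≡n (ℕ.<⇒≤ (toℕ<n d))) ⟩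
    K % K                                   ≡⟨ [m+n]%n≡m%n 0 K ⟩
    0                                       ∎)

  ⊞-identityʳ : (j : Fin K) → j ⊞ Fin.zero ≡ j
  ⊞-identityʳ j = ≡.trans (⊞-comm j Fin.zero) (⊞-identityˡ j)

  rotate : Fin K → Permutation′ K
  rotate d = permutation (_⊞ d) (_⊞ ⊟ d)
    (cancel (≡.trans (⊞-comm (⊟ d) d) (⊞-inverseʳ d))) (cancel (⊞-inverseʳ d))
    where
    cancel : ∀ {a b} → a ⊞ b ≡ Fin.zero → ∀ j → (j ⊞ a) ⊞ b ≡ j
    cancel {a} {b} a⊞b≡0 j = ≡.trans (⊞-assoc j a b) (≡.trans (≡.cong (j ⊞_) a⊞b≡0) (⊞-identityʳ j))

module ListSums {c ℓ : Level} (S : CommutativeSemiring c ℓ) where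
  open CommutativeSemiring S
  open import Algebra.Properties.CommutativeSemigroup +-commutativeSemigroup
    using () renaming (interchange to +-interchange)
  open import Algebra.Properties.Semiring.Sum semiring
    using (sum-syntax; ∑-distrib-+; sum-replicate-zero)
  import Data.Fin as Fin
  open import Data.List using (List; []; _∷_; _++_; map; concat; tabulate; length; lookup)

  private
    variable
      a b : Level
      A : Set a
      B : Set b

  ∑ᴸ : (A → Carrier) → List A → Carrier
  ∑ᴸ f []       = 0#
  ∑ᴸ f (x ∷ xs) = f x + ∑ᴸ f xs

  ∑ᴸ-cong : ∀ {f g : A → Carrier} → (∀ x → f x ≈ g x) → ∀ xs → ∑ᴸ f xs ≈ ∑ᴸ g xs
  ∑ᴸ-cong f≈g []       = refl
  ∑ᴸ-cong f≈g (x ∷ xs) = +-cong (f≈g x) (∑ᴸ-cong f≈g xs)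

  ∑ᴸ-zero : ∀ (xs : List A) → ∑ᴸ (λ _ → 0#) xs ≈ 0#
  ∑ᴸ-zero []       = refl
  ∑ᴸ-zero (x ∷ xs) = trans (+-identityˡ _) (∑ᴸ-zero xs)

  ∑ᴸ-distrib-+ : ∀ (f g : A → Carrier) xs → ∑ᴸ (λ x → f x + g x) xs ≈ ∑ᴸ f xs + ∑ᴸ g xs
  ∑ᴸ-distrib-+ f g []       = sym (+-identityˡ 0#)
  ∑ᴸ-distrib-+ f g (x ∷ xs) = trans (+-congˡ (∑ᴸ-distrib-+ f g xs)) (+-interchange (f x) (g x) _ _)

  *-distribˡ-∑ᴸ : ∀ y (f : A → Carrier) xs → y * ∑ᴸ f xs ≈ ∑ᴸ (λ x → y * f x) xs
  *-distribˡ-∑ᴸ y f []       = zeroʳ y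
  *-distribˡ-∑ᴸ y f (x ∷ xs) = trans (distribˡ y (f x) _) (+-congˡ (*-distribˡ-∑ᴸ y f xs))

  ∑ᴸ-++ : ∀ (f : A → Carrier) xs ys → ∑ᴸ f (xs ++ ys) ≈ ∑ᴸ f xs + ∑ᴸ f ys
  ∑ᴸ-++ f []       ys = sym (+-identityˡ _)
  ∑ᴸ-++ f (x ∷ xs) ys = trans (+-congˡ (∑ᴸ-++ f xs ys)) (sym (+-assoc (f x) _ _))

  ∑ᴸ-map : ∀ (f : B → Carrier) (g : A → B) xs → ∑ᴸ f (map g xs) ≡ ∑ᴸ (λ x → f (g x)) xs
  ∑ᴸ-map f g []       = ≡.refl
  ∑ᴸ-map f g (x ∷ xs) = ≡.cong (f (g x) +_) (∑ᴸ-map f g xs)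

  ∑ᴸ-comm : ∀ (f : A → B → Carrier) xs ys → ∑ᴸ (λ x → ∑ᴸ (f x) ys) xs ≈ ∑ᴸ (λ y → ∑ᴸ (λ x → f x y) xs) ys
  ∑ᴸ-comm f []       ys = sym (∑ᴸ-zero ys)
  ∑ᴸ-comm f (x ∷ xs) ys = trans (+-congˡ (∑ᴸ-comm f xs ys)) (sym (∑ᴸ-distrib-+ (f x) _ ys))

  ∑-∑ᴸ-comm : ∀ {n} (f : Fin n → A → Carrier) xs → ∑[ j < n ] ∑ᴸ (f j) xs ≈ ∑ᴸ (λ x → ∑[ j < n ] f j x) xs
  ∑-∑ᴸ-comm {n = n} f []       = sum-replicate-zero n
  ∑-∑ᴸ-comm         f (x ∷ xs) =
    trans (∑-distrib-+ (λ j → f j x) (λ j → ∑ᴸ (f j) xs)) (+-congˡ (∑-∑ᴸ-comm f xs))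

  ∑ᴸ-concat-tabulate : ∀ (f : A → Carrier) {n} (g : Fin n → List A) →
                       ∑ᴸ f (concat (tabulate g)) ≈ ∑[ j < n ] ∑ᴸ f (g j)
  ∑ᴸ-concat-tabulate f {zero}  g = refl
  ∑ᴸ-concat-tabulate f {suc n} g =
    trans (∑ᴸ-++ f (g Fin.zero) _) (+-congˡ (∑ᴸ-concat-tabulate f (λ j → g (Fin.suc j))))

  ∑ᴸ≡sum-lookup : ∀ (f : A → Carrier) xs → ∑ᴸ f xs ≡ ∑[ r < length xs ] f (lookup xs r)
  ∑ᴸ≡sum-lookup f []       = ≡.refl
  ∑ᴸ≡sum-lookup f (x ∷ xs) = ≡.cong (f x +_) (∑ᴸ≡sum-lookup f xs)

module ElementarySymmetric {c ℓ : Level} (R : CommutativeRing c ℓ) where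
  open CommutativeRing R
  open import Algebra.Properties.Semiring.Exp semiring using (_^_)
  open import Algebra.Properties.Semiring.Mult semiring using (_×_)
  open import Algebra.Properties.Semiring.Sum semiring
    using (sum; sum-syntax; sum-cong-≋; sum-cong-≗; ∑-distrib-+; *-distribˡ-sum; sum-init-last;
           sum-replicate-zero)
  open import Data.Fin as Fin using (toℕ; inject₁)
  open import Data.Fin.Properties using (toℕ-inject₁; toℕ-fromℕ)
  open import Data.List using (List; []; _∷_; length)
  open RingSolver R
  open import Data.Integer using (1ℤ)
  open ListSums commutativeSemiring using (∑ᴸ)
  open import Relation.Binary.Reasoning.Setoid setoid

  e : List Carrier → ℕ → Carrier
  e rs       zero    = 1#
  e []       (suc m) = 0#
  e (x ∷ rs) (suc m) = e rs (suc m) + x * e rs m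

  -- e′ rs m r = e rs (m ∸ r) when r ≤ m, but 0 when r > m.
  e′ : List Carrier → ℕ → ℕ → Carrier
  e′ rs m       zero    = e rs m
  e′ rs zero    (suc r) = 0#
  e′ rs (suc m) (suc r) = e′ rs m r

  e′-∸ : ∀ rs {m r} → r ℕ.≤ m → e′ rs m r ≡ e rs (m ℕ.∸ r)
  e′-∸ rs {r = zero}  _           = ≡.refl
  e′-∸ rs {r = suc r} (ℕ.s≤s r≤m) = e′-∸ rs r≤m

  e′-> : ∀ rs {m r} → m ℕ.< r → e′ rs m r ≡ 0#
  e′-> rs {zero}  (ℕ.s≤s _)   = ≡.refl
  e′-> rs {suc m} (ℕ.s≤s m<r) = e′-> rs m<r

  e-> : ∀ rs {m} → length rs ℕ.< m → e rs m ≈ 0#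
  e-> []       {suc m} _           = refl
  e-> (x ∷ rs) {suc m} (ℕ.s≤s l<m) = begin
    e rs (suc m) + x * e rs m  ≈⟨ +-cong (e-> rs (ℕ.m<n⇒m<1+n l<m)) (*-congˡ (e-> rs l<m)) ⟩
    0# + x * 0#                ≈⟨ trans (+-identityˡ _) (zeroʳ x) ⟩
    0#                         ∎

  e′-∷ : ∀ x rs m r → e′ (x ∷ rs) m r ≈ e′ rs m r + x * e′ rs m (suc r)
  e′-∷ x rs zero    zero    = sym (trans (+-congˡ (zeroʳ x)) (+-identityʳ _))
  e′-∷ x rs (suc m) zero    = refl
  e′-∷ x rs zero    (suc r) = sym (trans (+-congˡ (zeroʳ x)) (+-identityʳ _))
  e′-∷ x rs (suc m) (suc r) = e′-∷ x rs m r

  powerSum : List Carrier → ℕ → Carrier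
  powerSum rs r = ∑ᴸ (_^ r) rs

  newtonTerm : List Carrier → ℕ → ℕ → Carrier
  newtonTerm rs m r = (- 1#) ^ r * (e′ rs m (suc r) * powerSum rs (suc r))

  newtonSum : List Carrier → ℕ → Carrier
  newtonSum rs m = ∑[ r < m ] newtonTerm rs m (toℕ r)

  private
    newRootTerm : Carrier → List Carrier → ℕ → ℕ → Carrier
    newRootTerm x rs m r = (- 1#) ^ r * (e′ (x ∷ rs) m (suc r) * x ^ suc r)

    newRootSum : Carrier → List Carrier → ℕ → Carrier
    newRootSum x rs m = ∑[ r < m ] newRootTerm x rs m (toℕ r)

    newRootSum≈ : ∀ x rs m → newRootSum x rs m ≈ x * e′ rs m 1
    newRootSum≈ x rs zero    = sym (zeroʳ x)
    newRootSum≈ x rs (suc m) = begin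
      1# * (e (x ∷ rs) m * (x * 1#)) + ∑[ r < m ] newRootTerm x rs (suc m) (suc (toℕ r))
        ≈⟨ +-cong (solve 2 (λ E x → con 1ℤ :* (E :* (x :* con 1ℤ)) := E :* x) refl (e (x ∷ rs) m) x)
                  (sum-cong-≋ {m} λ r → shift-term (toℕ r)) ⟩
      e (x ∷ rs) m * x + ∑[ r < m ] (- x * newRootTerm x rs m (toℕ r))
        ≈⟨ +-cong (*-congʳ (e′-∷ x rs m 0))
                  (sym (*-distribˡ-sum {m} (- x) (λ r → newRootTerm x rs m (toℕ r)))) ⟩
      (e rs m + x * e′ rs m 1) * x + - x * newRootSum x rs m
        ≈⟨ +-congˡ (*-congˡ (newRootSum≈ x rs m)) ⟩
      (e rs m + x * e′ rs m 1) * x + - x * (x * e′ rs m 1)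
        ≈⟨ solve 3 (λ a x b → (a :+ x :* b) :* x :+ (:- x) :* (x :* b) := x :* a)
                   refl (e rs m) x (e′ rs m 1) ⟩
      x * e rs m ∎
      where
      shift-term : ∀ r → newRootTerm x rs (suc m) (suc r) ≈ - x * newRootTerm x rs m r
      shift-term r = solve 4 (λ s E x X → (:- con 1ℤ :* s) :* (E :* (x :* X)) := (:- x) :* (s :* (E :* X)))
                       refl ((- 1#) ^ r) (e′ (x ∷ rs) m (suc r)) x (x ^ suc r)

    newtonTerm-∷ : ∀ x rs m r → newtonTerm (x ∷ rs) (suc m) r
                   ≈ (newtonTerm rs (suc m) r + x * newtonTerm rs m r) + newRootTerm x rs (suc m) r
    newtonTerm-∷ x rs m r = begin
      s * (E * (X + Q))
        ≈⟨ solve 4 (λ s E X Q → s :* (E :* (X :+ Q)) := s :* (E :* Q) :+ s :* (E :* X)) refl s E X Q ⟩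
      s * (E * Q) + s * (E * X)
        ≈⟨ +-congʳ (*-congˡ (*-congʳ (e′-∷ x rs (suc m) (suc r)))) ⟩
      s * ((E₁ + x * E₂) * Q) + s * (E * X)
        ≈⟨ +-congʳ (solve 5 (λ s E₁ x E₂ Q → s :* ((E₁ :+ x :* E₂) :* Q)
                                          := s :* (E₁ :* Q) :+ x :* (s :* (E₂ :* Q)))
                            refl s E₁ x E₂ Q) ⟩
      (s * (E₁ * Q) + x * (s * (E₂ * Q))) + s * (E * X) ∎
      where
      s E E₁ E₂ X Q : Carrier
      s  = (- 1#) ^ r
      E  = e′ (x ∷ rs) (suc m) (suc r)
      E₁ = e′ rs (suc m) (suc r)
      E₂ = e′ rs m (suc r)
      X  = x ^ suc r
      Q  = powerSum rs (suc r)

    newtonSum-pad : ∀ rs m → ∑[ r < suc m ] newtonTerm rs m (toℕ r) ≈ newtonSum rs m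
    newtonSum-pad rs m = begin
      ∑[ r < suc m ] newtonTerm rs m (toℕ r)
        ≈⟨ sum-init-last (λ r → newtonTerm rs m (toℕ r)) ⟩
      ∑[ r < m ] newtonTerm rs m (toℕ (inject₁ r)) + newtonTerm rs m (toℕ (Fin.fromℕ m))
        ≡⟨ ≡.cong₂ _+_ (sum-cong-≗ {m} λ r → ≡.cong (newtonTerm rs m) (toℕ-inject₁ r))
                       (≡.cong (newtonTerm rs m) (toℕ-fromℕ m)) ⟩
      newtonSum rs m + newtonTerm rs m m
        ≈⟨ +-congˡ top≈0 ⟩
      newtonSum rs m + 0#
        ≈⟨ +-identityʳ _ ⟩
      newtonSum rs m ∎
      where
      top≈0 : newtonTerm rs m m ≈ 0#
      top≈0 = trans (*-congˡ (trans (*-congʳ (reflexive (e′-> rs (ℕ.n<1+n m)))) (zeroˡ _))) (zeroʳ _)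

  newton : ∀ rs m → m × 1# * e rs m ≈ newtonSum rs m
  newton []       zero    = zeroˡ 1#
  newton []       (suc m) = trans (zeroʳ _) (sym (trans
    (sum-cong-≋ {suc m} λ r → trans (*-congˡ (zeroʳ (e′ [] (suc m) (suc (toℕ r))))) (zeroʳ ((- 1#) ^ toℕ r)))
    (sum-replicate-zero (suc m))))
  newton (x ∷ rs) zero    = zeroˡ 1#
  newton (x ∷ rs) (suc m) = sym (begin
    newtonSum (x ∷ rs) (suc m)
      ≈⟨ sum-cong-≋ {suc m} (λ r → newtonTerm-∷ x rs m (toℕ r)) ⟩
    ∑[ r < suc m ] ((A r + x * B r) + C r)
      ≈⟨ trans (∑-distrib-+ (λ r → A r + x * B r) C) (+-congʳ (∑-distrib-+ A (λ r → x * B r))) ⟩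
    (newtonSum rs (suc m) + ∑[ r < suc m ] (x * B r)) + newRootSum x rs (suc m)
      ≈⟨ +-cong (+-cong (sym (newton rs (suc m))) (trans (sym (*-distribˡ-sum x B)) (*-congˡ ∑B≈)))
                (newRootSum≈ x rs (suc m)) ⟩
    ((1# + m × 1#) * e rs (suc m) + x * (m × 1# * e rs m)) + x * e rs m
      ≈⟨ solve 4 (λ f a x b → ((con 1ℤ :+ f) :* a :+ x :* (f :* b)) :+ x :* b
                           := (con 1ℤ :+ f) :* (a :+ x :* b))
                 refl (m × 1#) (e rs (suc m)) x (e rs m) ⟩
    (1# + m × 1#) * (e rs (suc m) + x * e rs m) ∎)
    where
    A B C : Fin (suc m) → Carrier
    A r = newtonTerm rs (suc m) (toℕ r)
    B r = newtonTerm rs m (toℕ r)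
    C r = newRootTerm x rs (suc m) (toℕ r)
    ∑B≈ : sum B ≈ m × 1# * e rs m
    ∑B≈ = trans (newtonSum-pad rs m) (sym (newton rs m))

module FallingFactorials {c ℓ : Level} (R : CommutativeRing c ℓ) where
  open CommutativeRing R
  open import Algebra.Properties.Semiring.Exp semiring using (_^_)
  open import Algebra.Properties.Semiring.Mult semiring using (_×_)
  open import Algebra.Properties.CommutativeSemigroup *-commutativeSemigroup using (x∙yz≈y∙xz)
  open import Data.List using (List; []; _∷_; downFrom; applyDownFrom)
  open import Data.List.Relation.Unary.All using (All; []; _∷_)
  open RingSolver R
  open import Data.Integer using (0ℤ; 1ℤ)
  open ListSums commutativeSemiring
  open import Relation.Binary.Reasoning.Setoid setoid

  ∏⁺ : List Carrier → Carrier → Carrier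
  ∏⁺ []       y = 1#
  ∏⁺ (a ∷ as) y = (y + a) * ∏⁺ as y

  fallingShifts : ℕ → List Carrier
  fallingShifts = applyDownFrom (λ s → - (s × 1#))

  ff : ℕ → Carrier → Carrier
  ff n = ∏⁺ (fallingShifts n)

  ff-shift : ∀ n y → ff (suc n) (1# + y) ≈ (1# + y) * ff n y
  ff-shift zero    y = solve 1 (λ y → ((con 1ℤ :+ y) :- con 0ℤ) :* con 1ℤ := (con 1ℤ :+ y) :* con 1ℤ) refl y
  ff-shift (suc n) y = begin
    ((1# + y) - (1# + n × 1#)) * ff (suc n) (1# + y)
      ≈⟨ *-congˡ (ff-shift n y) ⟩
    ((1# + y) - (1# + n × 1#)) * ((1# + y) * ff n y)
      ≈⟨ solve 3 (λ y F f → ((con 1ℤ :+ y) :- (con 1ℤ :+ f)) :* ((con 1ℤ :+ y) :* F)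
                           := (con 1ℤ :+ y) :* ((y :- f) :* F))
                 refl y (ff n y) (n × 1#) ⟩
    (1# + y) * ((y - n × 1#) * ff n y) ∎

  ff-suc-1+ : ∀ n y → ff (suc n) (1# + y) ≈ ∏⁺ (1# ∷ fallingShifts n) y
  ff-suc-1+ n y = trans (ff-shift n y) (*-congʳ (+-comm 1# y))

  ff-difference : ∀ n y → suc n × 1# * ff n y ≈ ff (suc n) (1# + y) - ff (suc n) y
  ff-difference n y = begin
    (1# + n × 1#) * ff n y
      ≈⟨ solve 3 (λ y F f → (con 1ℤ :+ f) :* F := (con 1ℤ :+ y) :* F :- (y :- f) :* F)
                 refl y (ff n y) (n × 1#) ⟩
    (1# + y) * ff n y - (y - n × 1#) * ff n y
      ≈⟨ +-congʳ (sym (ff-shift n y)) ⟩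
    ff (suc n) (1# + y) - ff (suc n) y ∎

  telescope : ∀ e b n → suc e × 1# * ∑ᴸ (λ t → ff e ((t ℕ.+ b) × 1#)) (downFrom n)
                        ≈ ff (suc e) ((n ℕ.+ b) × 1#) - ff (suc e) (b × 1#)
  telescope e b zero    = trans (zeroʳ _) (sym (-‿inverseʳ _))
  telescope e b (suc n) = begin
    suc e × 1# * (ff e ((n ℕ.+ b) × 1#) + S)
      ≈⟨ distribˡ _ _ _ ⟩
    suc e × 1# * ff e ((n ℕ.+ b) × 1#) + suc e × 1# * S
      ≈⟨ +-cong (ff-difference e _) (telescope e b n) ⟩
    (A - Z) + (Z - B)
      ≈⟨ solve 3 (λ A Z B → (A :- Z) :+ (Z :- B) := A :- B) refl A Z B ⟩
    A - B ∎
    where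
    S A Z B : Carrier
    S = ∑ᴸ (λ t → ff e ((t ℕ.+ b) × 1#)) (downFrom n)
    A = ff (suc e) ((suc n ℕ.+ b) × 1#)
    Z = ff (suc e) ((n ℕ.+ b) × 1#)
    B = ff (suc e) (b × 1#)

  record FFTerm : Set c where
    constructor _·ff_
    field
      coefficient : Carrier → Carrier
      degree      : ℕ
  open FFTerm public

  ⟦_⟧ff : List FFTerm → Carrier → Carrier → Carrier
  ⟦ ts ⟧ff β y = ∑ᴸ (λ t → coefficient t β * ff (degree t) y) ts

  mulLinear : List FFTerm → List FFTerm
  mulLinear []              = []
  mulLinear (g ·ff n ∷ ts) = g ·ff suc n ∷ (λ β → g β * (n × 1# - β)) ·ff n ∷ mulLinear ts

  private
    linear-ff : ∀ n β y → (- β + y) * ff n y ≈ ff (suc n) y + (n × 1# - β) * ff n y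
    linear-ff n β y =
      solve 4 (λ β y F f → (:- β :+ y) :* F := (y :- f) :* F :+ (f :- β) :* F) refl β y (ff n y) (n × 1#)

  ⟦mulLinear⟧ : ∀ ts β y → ⟦ mulLinear ts ⟧ff β y ≈ (- β + y) * ⟦ ts ⟧ff β y
  ⟦mulLinear⟧ []              β y = sym (zeroʳ _)
  ⟦mulLinear⟧ (g ·ff n ∷ ts) β y = begin
    g β * ff (suc n) y + (g β * (n × 1# - β) * ff n y + ⟦ mulLinear ts ⟧ff β y)
      ≈⟨ sym (+-assoc _ _ _) ⟩
    (g β * ff (suc n) y + g β * (n × 1# - β) * ff n y) + ⟦ mulLinear ts ⟧ff β y
      ≈⟨ +-cong (trans (+-congˡ (*-assoc _ _ _)) (sym (distribˡ _ _ _))) (⟦mulLinear⟧ ts β y) ⟩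
    g β * (ff (suc n) y + (n × 1# - β) * ff n y) + (- β + y) * ⟦ ts ⟧ff β y
      ≈⟨ +-congʳ (trans (*-congˡ (sym (linear-ff n β y))) (x∙yz≈y∙xz _ _ _)) ⟩
    (- β + y) * (g β * ff n y) + (- β + y) * ⟦ ts ⟧ff β y
      ≈⟨ sym (distribˡ _ _ _) ⟩
    (- β + y) * ⟦ g ·ff n ∷ ts ⟧ff β y ∎

  lowerFF : ℕ → List FFTerm
  lowerFF zero    = []
  lowerFF (suc r) = (λ β → r × 1# - β) ·ff r ∷ mulLinear (lowerFF r)

  pow-ff : ∀ r β y → (- β + y) ^ r ≈ ff r y + ⟦ lowerFF r ⟧ff β y
  pow-ff zero    β y = sym (+-identityʳ 1#)
  pow-ff (suc r) β y = begin
    (- β + y) * (- β + y) ^ r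
      ≈⟨ *-congˡ (pow-ff r β y) ⟩
    (- β + y) * (ff r y + ⟦ lowerFF r ⟧ff β y)
      ≈⟨ distribˡ _ _ _ ⟩
    (- β + y) * ff r y + (- β + y) * ⟦ lowerFF r ⟧ff β y
      ≈⟨ +-cong (linear-ff r β y) (sym (⟦mulLinear⟧ (lowerFF r) β y)) ⟩
    (ff (suc r) y + (r × 1# - β) * ff r y) + ⟦ mulLinear (lowerFF r) ⟧ff β y
      ≈⟨ +-assoc _ _ _ ⟩
    ff (suc r) y + ⟦ lowerFF (suc r) ⟧ff β y ∎

  lowerFF-degree : ∀ r → All (λ t → degree t ℕ.< r) (lowerFF r)
  lowerFF-degree zero    = []
  lowerFF-degree (suc r) = ℕ.≤-refl ∷ mulLinear-degree (lowerFF r) (lowerFF-degree r)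
    where
    mulLinear-degree : ∀ ts → All (λ t → degree t ℕ.< r) ts → All (λ t → degree t ℕ.< suc r) (mulLinear ts)
    mulLinear-degree []       []          = []
    mulLinear-degree (_ ∷ ts) (n<r ∷ n<rs) = ℕ.s≤s n<r ∷ ℕ.m<n⇒m<1+n n<r ∷ mulLinear-degree ts n<rs

  powerSum-ff : ∀ r β (ys : List Carrier) →
                ∑ᴸ (λ y → (- β + y) ^ r) ys
                  ≈ ∑ᴸ (ff r) ys + ∑ᴸ (λ u → coefficient u β * ∑ᴸ (ff (degree u)) ys) (lowerFF r)
  powerSum-ff r β ys = begin
    ∑ᴸ (λ y → (- β + y) ^ r) ys
      ≈⟨ ∑ᴸ-cong (pow-ff r β) ys ⟩
    ∑ᴸ (λ y → ff r y + ⟦ lowerFF r ⟧ff β y) ys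
      ≈⟨ ∑ᴸ-distrib-+ (ff r) (⟦ lowerFF r ⟧ff β) ys ⟩
    ∑ᴸ (ff r) ys + ∑ᴸ (λ y → ∑ᴸ (λ u → coefficient u β * ff (degree u) y) (lowerFF r)) ys
      ≈⟨ +-congˡ (∑ᴸ-comm (λ y u → coefficient u β * ff (degree u) y) ys (lowerFF r)) ⟩
    ∑ᴸ (ff r) ys + ∑ᴸ (λ u → ∑ᴸ (λ y → coefficient u β * ff (degree u) y) ys) (lowerFF r)
      ≈⟨ +-congˡ (∑ᴸ-cong (λ u → sym (*-distribˡ-∑ᴸ (coefficient u β) (ff (degree u)) ys)) (lowerFF r)) ⟩
    ∑ᴸ (ff r) ys + ∑ᴸ (λ u → coefficient u β * ∑ᴸ (ff (degree u)) ys) (lowerFF r) ∎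

module RealFacts {c ℓ : Level} (ℝ : RealField c ℓ) where
  open RealField ℝ
  import Data.Fin as Fin
  open import Algebra.Properties.Semiring.Sum semiring using (sum)
  open import Algebra.Properties.Semiring.Mult semiring using (_×_)
  open import Data.Sum using (inj₁; inj₂)
  open import Data.Product using (proj₁; proj₂)
  open import Relation.Nullary using (¬_)
  open import Algebra.Properties.Ring ring using (-1*x≈-x; -‿involutive)
  open import Relation.Binary.Reasoning.Setoid setoid
  open import Relation.Binary.Structures using (IsTotalOrder)
  private module ≤ = IsTotalOrder isTotalOrder

  fromℕ≡× : ∀ n → fromℕ ℝ n ≡ n × 1#
  fromℕ≡× zero    = ≡.refl
  fromℕ≡× (suc n) = ≡.cong (1# +_) (fromℕ≡× n)

  -- The order is needed only to see that the positive integers are invertible.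
  private
    ≤-respʳ-≈ : ∀ {x y z} → y ≈ z → x ≤ y → x ≤ z
    ≤-respʳ-≈ y≈z x≤y = ≤.trans x≤y (≤.reflexive y≈z)

    ≤-respˡ-≈ : ∀ {x y z} → x ≈ y → x ≤ z → y ≤ z
    ≤-respˡ-≈ x≈y x≤z = ≤.trans (≤.reflexive (sym x≈y)) x≤z

    0≤1 : 0# ≤ 1#
    0≤1 with ≤.total 0# 1#
    ... | inj₁ 0≤1 = 0≤1
    ... | inj₂ 1≤0 = ≤-respʳ-≈ -1*-1≈1 (*-nonneg 0≤-1 0≤-1)
      where
      0≤-1 : 0# ≤ (- 1#)
      0≤-1 = ≤-respʳ-≈ (+-identityˡ _) (≤-respˡ-≈ (-‿inverseʳ 1#) (+-mono-≤ (- 1#) 1≤0))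
      -1*-1≈1 : - 1# * - 1# ≈ 1#
      -1*-1≈1 = trans (-1*x≈-x (- 1#)) (-‿involutive 1#)

    0≤n : ∀ n → 0# ≤ (n × 1#)
    0≤n zero    = ≤.refl
    0≤n (suc n) = ≤.trans (0≤n n) (≤-respˡ-≈ (+-identityˡ _) (+-mono-≤ (n × 1#) 0≤1))

    1+n≉0 : ∀ n → ¬ (suc n × 1# ≈ 0#)
    1+n≉0 n 1+n≈0 = nontrivial (≤.antisym 0≤1 (≤-respʳ-≈ 1+n≈0 1≤1+n))
      where
      1≤1+n : 1# ≤ (suc n × 1#)
      1≤1+n = ≤-respˡ-≈ (+-identityˡ 1#) (≤-respʳ-≈ (+-comm _ _) (+-mono-≤ 1# (0≤n n)))

  ∑≡sum : ∀ n (f : Fin n → Carrier) → ∑ ℝ n f ≡ sum f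
  ∑≡sum zero    f = ≡.refl
  ∑≡sum (suc n) f = ≡.cong (f Fin.zero +_) (∑≡sum n (λ i → f (Fin.suc i)))

  recip : ℕ → Carrier
  recip n = proj₁ (inverse (suc n × 1#) (1+n≉0 n))

  recip-inverseˡ : ∀ n → recip n * suc n × 1# ≈ 1#
  recip-inverseˡ n = trans (*-comm _ _) (proj₂ (inverse (suc n × 1#) (1+n≉0 n)))

  recip-unique : ∀ n {a b} → suc n × 1# * a ≈ b → a ≈ recip n * b
  recip-unique n {a} {b} [1+n]a≈b = begin
    a                              ≈⟨ sym (*-identityˡ a) ⟩
    1# * a                         ≈⟨ *-congʳ (sym (recip-inverseˡ n)) ⟩
    (recip n * suc n × 1#) * a     ≈⟨ *-assoc _ _ _ ⟩
    recip n * (suc n × 1# * a)     ≈⟨ *-congˡ [1+n]a≈b ⟩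
    recip n * b                    ∎

module Polynomials {c ℓ : Level} (ℝ : RealField c ℓ) where
  open RealField ℝ
  open import Algebra.Properties.CommutativeSemigroup +-commutativeSemigroup
    using () renaming (interchange to +-interchange)
  open import Data.List using (List; []; _∷_; _++_; map; foldr; concat; tabulate; applyDownFrom; length)
  open import Data.List.Properties using (length-++; length-applyDownFrom)
  open import Data.Fin as Fin using (toℕ)
  open import Algebra.Properties.Semiring.Sum semiring using (sum-syntax; sum-replicate-zero; sum-cong-≋)
  open import Data.Nat using (NonZero)
  open ElementarySymmetric commRing using (e; e′; e′-∸; e->; e′-∷)
  open import Relation.Binary.Reasoning.Setoid setoid

  infixl 6 _⊕ᵖ_
  infixl 7 _⊗ᵖ_
  infix  4 _≋_

  _⊕ᵖ_ _⊗ᵖ_ : Poly ℝ → Poly ℝ → Poly ℝ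
  _⊕ᵖ_ = _⊕_ ℝ
  _⊗ᵖ_ = _⊗_ ℝ

  _[_] : Poly ℝ → ℕ → Carrier
  p [ n ] = coeff ℝ p n

  _≋_ : Poly ℝ → Poly ℝ → Set ℓ
  p ≋ q = ∀ n → p [ n ] ≈ q [ n ]

  shift : (ℕ → Carrier) → ℕ → Carrier
  shift f zero    = 0#
  shift f (suc n) = f n

  shift-cong : ∀ {f g} → (∀ n → f n ≈ g n) → ∀ n → shift f n ≈ shift g n
  shift-cong f≈g zero    = refl
  shift-cong f≈g (suc n) = f≈g n

  [⊕] : ∀ p q n → (p ⊕ᵖ q) [ n ] ≈ p [ n ] + q [ n ]
  [⊕] []      q       n       = sym (+-identityˡ _)
  [⊕] (a ∷ p) []      zero    = sym (+-identityʳ a)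
  [⊕] (a ∷ p) []      (suc n) = sym (+-identityʳ _)
  [⊕] (a ∷ p) (b ∷ q) zero    = refl
  [⊕] (a ∷ p) (b ∷ q) (suc n) = [⊕] p q n

  [scale] : ∀ a p n → map (a *_) p [ n ] ≈ a * p [ n ]
  [scale] a []      n       = sym (zeroʳ a)
  [scale] a (b ∷ p) zero    = refl
  [scale] a (b ∷ p) (suc n) = [scale] a p n

  [0∷] : ∀ p n → (0# ∷ p) [ n ] ≈ shift (p [_]) n
  [0∷] p zero    = refl
  [0∷] p (suc n) = refl

  [linMul] : ∀ a p n → linMul ℝ a p [ n ] ≈ a * p [ n ] + shift (p [_]) n
  [linMul] a p n = trans ([⊕] (map (a *_) p) (0# ∷ p) n) (+-cong ([scale] a p n) ([0∷] p n))

  [∷⊗] : ∀ a p q n → ((a ∷ p) ⊗ᵖ q) [ n ] ≈ a * q [ n ] + shift ((p ⊗ᵖ q) [_]) n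
  [∷⊗] a p q n = trans ([⊕] (map (a *_) q) (0# ∷ (p ⊗ᵖ q)) n) (+-cong ([scale] a q n) ([0∷] (p ⊗ᵖ q) n))

  ⊕-cong : ∀ {p p′ q q′} → p ≋ p′ → q ≋ q′ → p ⊕ᵖ q ≋ p′ ⊕ᵖ q′
  ⊕-cong {p} {p′} {q} {q′} p≋p′ q≋q′ n =
    trans ([⊕] p q n) (trans (+-cong (p≋p′ n) (q≋q′ n)) (sym ([⊕] p′ q′ n)))

  linMul-cong : ∀ a {p q} → p ≋ q → linMul ℝ a p ≋ linMul ℝ a q
  linMul-cong a {p} {q} p≋q n =
    trans ([linMul] a p n) (trans (+-cong (*-congˡ (p≋q n)) (shift-cong p≋q n)) (sym ([linMul] a q n)))

  ⊗-congˡ : ∀ p {q q′} → q ≋ q′ → p ⊗ᵖ q ≋ p ⊗ᵖ q′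
  ⊗-congˡ []      q≋q′ n = refl
  ⊗-congˡ (a ∷ p) {q} {q′} q≋q′ n = begin
    ((a ∷ p) ⊗ᵖ q) [ n ]                      ≈⟨ [∷⊗] a p q n ⟩
    a * q [ n ] + shift ((p ⊗ᵖ q) [_]) n      ≈⟨ +-cong (*-congˡ (q≋q′ n)) (shift-cong (⊗-congˡ p q≋q′) n) ⟩
    a * q′ [ n ] + shift ((p ⊗ᵖ q′) [_]) n    ≈⟨ [∷⊗] a p q′ n ⟨
    ((a ∷ p) ⊗ᵖ q′) [ n ]                     ∎

  ⊗-distribʳ-⊕ : ∀ p p′ q → (p ⊕ᵖ p′) ⊗ᵖ q ≋ p ⊗ᵖ q ⊕ᵖ p′ ⊗ᵖ q
  ⊗-distribʳ-⊕ []      p′       q n = refl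
  ⊗-distribʳ-⊕ (a ∷ p) []       q n = sym (trans ([⊕] ((a ∷ p) ⊗ᵖ q) [] n) (+-identityʳ _))
  ⊗-distribʳ-⊕ (a ∷ p) (a′ ∷ p′) q n = begin
    (((a + a′) ∷ (p ⊕ᵖ p′)) ⊗ᵖ q) [ n ]
      ≈⟨ [∷⊗] (a + a′) (p ⊕ᵖ p′) q n ⟩
    (a + a′) * q [ n ] + shift (((p ⊕ᵖ p′) ⊗ᵖ q) [_]) n
      ≈⟨ +-cong (distribʳ _ a a′) (shift-+ n) ⟩
    (a * q [ n ] + a′ * q [ n ]) + (shift ((p ⊗ᵖ q) [_]) n + shift ((p′ ⊗ᵖ q) [_]) n)
      ≈⟨ +-interchange _ _ _ _ ⟩
    (a * q [ n ] + shift ((p ⊗ᵖ q) [_]) n) + (a′ * q [ n ] + shift ((p′ ⊗ᵖ q) [_]) n)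
      ≈⟨ +-cong ([∷⊗] a p q n) ([∷⊗] a′ p′ q n) ⟨
    ((a ∷ p) ⊗ᵖ q) [ n ] + ((a′ ∷ p′) ⊗ᵖ q) [ n ]
      ≈⟨ [⊕] ((a ∷ p) ⊗ᵖ q) ((a′ ∷ p′) ⊗ᵖ q) n ⟨
    ((a ∷ p) ⊗ᵖ q ⊕ᵖ (a′ ∷ p′) ⊗ᵖ q) [ n ] ∎
    where
    shift-+ : ∀ n → shift (((p ⊕ᵖ p′) ⊗ᵖ q) [_]) n ≈ shift ((p ⊗ᵖ q) [_]) n + shift ((p′ ⊗ᵖ q) [_]) n
    shift-+ zero    = sym (+-identityˡ 0#)
    shift-+ (suc n) = trans (⊗-distribʳ-⊕ p p′ q n) ([⊕] (p ⊗ᵖ q) (p′ ⊗ᵖ q) n)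

  scale-⊗ : ∀ a p q → map (a *_) p ⊗ᵖ q ≋ map (a *_) (p ⊗ᵖ q)
  scale-⊗ a []      q n = refl
  scale-⊗ a (b ∷ p) q n = begin
    ((a * b ∷ map (a *_) p) ⊗ᵖ q) [ n ]                ≈⟨ [∷⊗] (a * b) (map (a *_) p) q n ⟩
    a * b * q [ n ] + shift ((map (a *_) p ⊗ᵖ q) [_]) n ≈⟨ +-cong (*-assoc a b _) (shift-scale n) ⟩
    a * (b * q [ n ]) + a * shift ((p ⊗ᵖ q) [_]) n      ≈⟨ distribˡ a _ _ ⟨
    a * (b * q [ n ] + shift ((p ⊗ᵖ q) [_]) n)          ≈⟨ *-congˡ ([∷⊗] b p q n) ⟨
    a * ((b ∷ p) ⊗ᵖ q) [ n ]                            ≈⟨ [scale] a ((b ∷ p) ⊗ᵖ q) n ⟨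
    map (a *_) ((b ∷ p) ⊗ᵖ q) [ n ]                     ∎
    where
    shift-scale : ∀ n → shift ((map (a *_) p ⊗ᵖ q) [_]) n ≈ a * shift ((p ⊗ᵖ q) [_]) n
    shift-scale zero    = sym (zeroʳ a)
    shift-scale (suc n) = trans (scale-⊗ a p q n) ([scale] a (p ⊗ᵖ q) n)

  0∷-⊗ : ∀ p q → (0# ∷ p) ⊗ᵖ q ≋ 0# ∷ (p ⊗ᵖ q)
  0∷-⊗ p q n =
    trans ([∷⊗] 0# p q n) (trans (+-congʳ (zeroˡ _)) (trans (+-identityˡ _) (sym ([0∷] (p ⊗ᵖ q) n))))

  linMul-⊗ : ∀ a p q → linMul ℝ a p ⊗ᵖ q ≋ linMul ℝ a (p ⊗ᵖ q)
  linMul-⊗ a p q n = trans (⊗-distribʳ-⊕ (map (a *_) p) (0# ∷ p) q n)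
    (⊕-cong {map (a *_) p ⊗ᵖ q} {map (a *_) (p ⊗ᵖ q)} {(0# ∷ p) ⊗ᵖ q} (scale-⊗ a p q) (0∷-⊗ p q) n)

  fromRoots : List Carrier → Poly ℝ
  fromRoots = foldr (linMul ℝ) (constOne ℝ)

  fromRoots-++ : ∀ rs ss → fromRoots rs ⊗ᵖ fromRoots ss ≋ fromRoots (rs ++ ss)
  fromRoots-++ []       ss n = begin
    (constOne ℝ ⊗ᵖ fromRoots ss) [ n ]                 ≈⟨ [∷⊗] 1# [] (fromRoots ss) n ⟩
    1# * fromRoots ss [ n ] + shift ([] [_]) n         ≈⟨ +-cong (*-identityˡ _) (shift-[] n) ⟩
    fromRoots ss [ n ] + 0#                            ≈⟨ +-identityʳ _ ⟩
    fromRoots ss [ n ]                                 ∎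
    where
    shift-[] : ∀ n → shift ([] [_]) n ≈ 0#
    shift-[] zero    = refl
    shift-[] (suc n) = refl
  fromRoots-++ (r ∷ rs) ss n =
    trans (linMul-⊗ r (fromRoots rs) (fromRoots ss) n)
          (linMul-cong r {fromRoots rs ⊗ᵖ fromRoots ss} {fromRoots (rs ++ ss)} (fromRoots-++ rs ss) n)

  prodLin≡fromRoots : ∀ n g → prodLin ℝ n g ≡ fromRoots (applyDownFrom (λ t → g (suc t)) n)
  prodLin≡fromRoots zero    g = ≡.refl
  prodLin≡fromRoots (suc n) g = ≡.cong (linMul ℝ (g (suc n))) (prodLin≡fromRoots n g)

  ∏P-fromRoots : ∀ n (f : Fin n → Poly ℝ) (rs : Fin n → List Carrier) →
                 (∀ j → f j ≡ fromRoots (rs j)) → ∏P ℝ n f ≋ fromRoots (concat (tabulate rs))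
  ∏P-fromRoots zero    f rs f≡ k = refl
  ∏P-fromRoots (suc n) f rs f≡ k = begin
    (f Fin.zero ⊗ᵖ ∏P ℝ n (λ j → f (Fin.suc j))) [ k ]
      ≈⟨ ⊗-congˡ (f Fin.zero) (∏P-fromRoots n _ _ (λ j → f≡ (Fin.suc j))) k ⟩
    (f Fin.zero ⊗ᵖ fromRoots (concat (tabulate (λ j → rs (Fin.suc j))))) [ k ]
      ≡⟨ ≡.cong (λ p → (p ⊗ᵖ _) [ k ]) (f≡ Fin.zero) ⟩
    (fromRoots (rs Fin.zero) ⊗ᵖ fromRoots (concat (tabulate (λ j → rs (Fin.suc j))))) [ k ]
      ≈⟨ fromRoots-++ (rs Fin.zero) _ k ⟩
    fromRoots (concat (tabulate rs)) [ k ] ∎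

  [fromRoots] : ∀ rs n → fromRoots rs [ n ] ≈ e′ rs (length rs) n
  [fromRoots] []       zero    = refl
  [fromRoots] []       (suc n) = refl
  [fromRoots] (x ∷ rs) n = begin
    linMul ℝ x (fromRoots rs) [ n ]
      ≈⟨ [linMul] x (fromRoots rs) n ⟩
    x * fromRoots rs [ n ] + shift (fromRoots rs [_]) n
      ≈⟨ +-cong (*-congˡ ([fromRoots] rs n)) (shift-cong ([fromRoots] rs) n) ⟩
    x * e′ rs D n + shift (e′ rs D) n
      ≈⟨ +-comm _ _ ⟩
    shift (e′ rs D) n + x * e′ rs D n
      ≈⟨ +-congʳ (shift-e′ n) ⟩
    e′ rs (suc D) n + x * e′ rs (suc D) (suc n)
      ≈⟨ e′-∷ x rs (suc D) n ⟨
    e′ (x ∷ rs) (suc D) n ∎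
    where
    D : ℕ
    D = length rs
    shift-e′ : ∀ n → shift (e′ rs D) n ≈ e′ rs (suc D) n
    shift-e′ zero    = sym (e-> rs ℕ.≤-refl)
    shift-e′ (suc n) = refl

  [∑P] : ∀ n (f : Fin n → Poly ℝ) k → ∑P ℝ n f [ k ] ≈ ∑[ i < n ] f i [ k ]
  [∑P] zero    f k = refl
  [∑P] (suc n) f k = trans ([⊕] (f Fin.zero) _ k) (+-congˡ ([∑P] n (λ i → f (Fin.suc i)) k))

  coeffDown-∑P : ∀ n (f : Fin n → Poly ℝ) L m → coeffDown ℝ (∑P ℝ n f) L m ≈ ∑[ i < n ] coeffDown ℝ (f i) L m
  coeffDown-∑P n f L m with m ℕ.≤? L
  ... | yes _ = [∑P] n f (L ℕ.∸ m)
  ... | no  _ = sym (sum-replicate-zero n)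

  coeffDown-cong : ∀ {p q} L m → p ≋ q → coeffDown ℝ p L m ≈ coeffDown ℝ q L m
  coeffDown-cong L m p≋q with m ℕ.≤? L
  ... | yes _ = p≋q (L ℕ.∸ m)
  ... | no  _ = refl

  coeffDown-fromRoots : ∀ rs m → coeffDown ℝ (fromRoots rs) (length rs) m ≈ e rs m
  coeffDown-fromRoots rs m with m ℕ.≤? length rs
  ... | yes m≤l = begin
    fromRoots rs [ length rs ℕ.∸ m ]              ≈⟨ [fromRoots] rs _ ⟩
    e′ rs (length rs) (length rs ℕ.∸ m)           ≡⟨ e′-∸ rs (ℕ.m∸n≤m (length rs) m) ⟩
    e rs (length rs ℕ.∸ (length rs ℕ.∸ m))        ≡⟨ ≡.cong (e rs) (ℕ.m∸[m∸n]≡n m≤l) ⟩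
    e rs m                                       ∎
  ... | no  m≰l = sym (e-> rs (ℕ.≰⇒> m≰l))

  -- The roots of ∏_{h=a+1}^{xs} (N - β + h), in the order in which prodLin multiplies them.
  rootBlock : ℕ → Carrier → ℕ → List Carrier
  rootBlock xs β a = applyDownFrom (λ t → - β + fromℕ ℝ (a ℕ.+ suc t)) (xs ℕ.∸ a)

  roots : ∀ {k} .{{_ : NonZero k}} xs → (Fin k → Carrier) → Config ℝ k xs → Fin k → List Carrier
  roots {k} xs b x i = concat (tabulate {n = k} λ j → rootBlock xs (b (j ⊞ i)) (toℕ (x j)))

  length-rootBlocks : ∀ {n} xs (β : Fin n → Carrier) (x : Config ℝ n xs) →
                      length (concat (tabulate λ j → rootBlock xs (β j) (toℕ (x j)))) ≡ L ℝ n xs x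
  length-rootBlocks {zero}  xs β x = ≡.refl
  length-rootBlocks {suc n} xs β x = ≡.trans (length-++ (rootBlock xs (β Fin.zero) (toℕ (x Fin.zero))))
    (≡.cong₂ ℕ._+_ (length-applyDownFrom _ (xs ℕ.∸ toℕ (x Fin.zero)))
                   (length-rootBlocks xs (λ j → β (Fin.suc j)) (λ j → x (Fin.suc j))))

  coeffDown-P : ∀ {k} .{{_ : NonZero k}} xs b (x : Config ℝ k xs) m →
                coeffDown ℝ (P ℝ k xs b x) (L ℝ k xs x) m ≈ ∑[ i < k ] e (roots xs b x i) m
  coeffDown-P {k} xs b x m = begin
    coeffDown ℝ (P ℝ k xs b x) (L ℝ k xs x) m
      ≈⟨ coeffDown-∑P k _ (L ℝ k xs x) m ⟩
    ∑[ i < k ] coeffDown ℝ (∏P ℝ k (λ j → prodLin ℝ (xs ℕ.∸ toℕ (x j)) (g i j))) (L ℝ k xs x) m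
      ≈⟨ sum-cong-≋ {k} (λ i → coeffDown-cong (L ℝ k xs x) m
           (∏P-fromRoots k _ _ (λ j → prodLin≡fromRoots (xs ℕ.∸ toℕ (x j)) (g i j)))) ⟩
    ∑[ i < k ] coeffDown ℝ (fromRoots (roots xs b x i)) (L ℝ k xs x) m
      ≈⟨ sum-cong-≋ {k} coeffDown-roots ⟩
    ∑[ i < k ] e (roots xs b x i) m ∎
    where
    coeffDown-roots : ∀ i → coeffDown ℝ (fromRoots (roots xs b x i)) (L ℝ k xs x) m ≈ e (roots xs b x i) m
    coeffDown-roots i rewrite ≡.sym (length-rootBlocks xs (λ j → b (j ⊞ i)) x) =
      coeffDown-fromRoots (roots xs b x i) m
    g : Fin k → Fin k → ℕ → Carrier
    g i j t = - b (j ⊞ i) + fromℕ ℝ (toℕ (x j) ℕ.+ t)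

module CyclicTerms {c ℓ : Level} (ℝ : RealField c ℓ) (k' xs : ℕ) where
  open RealField ℝ
  open import Algebra.Properties.CommutativeSemigroup *-commutativeSemigroup
    using () renaming (interchange to *-interchange)
  open import Algebra.Properties.Semiring.Sum semiring
    using (sum; sum-syntax; sum-cong-≋; sum-cong-≗; ∑-distrib-+; *-distribˡ-sum; *-distribʳ-sum; ∑-comm;
           ∑-permute; sum-replicate; sum-replicate-zero)
  import Data.Fin as Fin
  open import Data.Product using (Σ; _,_)
  open import Data.List using (List; []; _∷_; _++_; map; length; lookup)
  open import Data.List.Relation.Unary.All using (All; []; _∷_)
  import Data.List.Relation.Unary.All as All
  open import Data.List.Relation.Unary.All.Properties using (++⁺; map⁺)
  open import Data.List.Properties using (length-++; length-map)
  open import Algebra.Properties.Semiring.Mult semiring using (_×_; ×-comm-*)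
  open CyclicIndex k'
  open ListSums commutativeSemiring
  open RealFacts ℝ using (recip; recip-inverseˡ; ∑≡sum)
  open FallingFactorials commRing using (∏⁺)
  open RingSolver commRing using (solve; _:=_; _:+_; _:*_)
  open import Relation.Binary.Reasoning.Setoid setoid

  private
    K : ℕ
    K = suc k'

  Cfg : Set
  Cfg = Config ℝ K xs

  ∑-rotate : ∀ d (f : Fin K → Carrier) → ∑[ j < K ] f (j ⊞ d) ≈ ∑[ j < K ] f j
  ∑-rotate d f = sym (∑-permute f (rotate d))

  Symmetric-* : ∀ {σ τ : Cfg → Carrier} → Symmetric ℝ σ → Symmetric ℝ τ → Symmetric ℝ (λ x → σ x * τ x)
  Symmetric-* σ-sym τ-sym π x = *-cong (σ-sym π x) (τ-sym π x)

  Symmetric-const : ∀ a → Symmetric ℝ {K} {xs} (λ _ → a)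
  Symmetric-const a π x = refl

  Symmetric-∑ : (h : Fin (suc xs) → Carrier) → Symmetric ℝ (λ (x : Cfg) → ∑[ j < K ] h (x j))
  Symmetric-∑ h π x = sym (∑-permute (λ j → h (x j)) π)

  monomial : List (Fin K) → Cfg → Fin K → Carrier
  monomial []       x j = 1#
  monomial (d ∷ ds) x j = val ℝ x (d ⊞ j) * monomial ds x j

  monomial-++ : ∀ ds ds′ x j → monomial (ds ++ ds′) x j ≈ monomial ds x j * monomial ds′ x j
  monomial-++ []       ds′ x j = sym (*-identityˡ _)
  monomial-++ (d ∷ ds) ds′ x j = trans (*-congˡ (monomial-++ ds ds′ x j)) (sym (*-assoc _ _ _))

  monomial-rotate : ∀ δ ds x j → monomial (map (_⊞ δ) ds) x j ≈ monomial ds x (δ ⊞ j)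
  monomial-rotate δ []       x j = refl
  monomial-rotate δ (d ∷ ds) x j =
    *-cong (reflexive (≡.cong (val ℝ x) (⊞-assoc d δ j))) (monomial-rotate δ ds x j)

  record Term : Set c where
    constructor _⟨_⟩
    field
      weight : Fin K → Carrier
      shifts : List (Fin K)
  open Term public

  ⟦_⟧ᵀ : Term → Cfg → Fin K → Carrier
  ⟦ t ⟧ᵀ x i = ∑[ j < K ] (weight t (j ⊞ i) * monomial (shifts t) x j)

  _⊛[_]_ : Term → Fin K → Term → Term
  t ⊛[ δ ] t′ = (λ u → weight t u * weight t′ (δ ⊞ u)) ⟨ shifts t ++ map (_⊞ δ) (shifts t′) ⟩

  ⟦⟧ᵀ-* : ∀ t t′ x i → ⟦ t ⟧ᵀ x i * ⟦ t′ ⟧ᵀ x i ≈ ∑[ δ < K ] ⟦ t ⊛[ δ ] t′ ⟧ᵀ x i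
  ⟦⟧ᵀ-* t t′ x i = begin
    sum A * sum B
      ≈⟨ *-distribʳ-sum (sum B) A ⟩
    ∑[ j < K ] (A j * sum B)
      ≈⟨ sum-cong-≋ {K} (λ j → *-distribˡ-sum (A j) B) ⟩
    ∑[ j < K ] ∑[ j′ < K ] (A j * B j′)
      ≈⟨ sum-cong-≋ {K} (λ j → sym (∑-rotate j (λ j′ → A j * B j′))) ⟩
    ∑[ j < K ] ∑[ δ < K ] (A j * B (δ ⊞ j))
      ≈⟨ ∑-comm (λ j δ → A j * B (δ ⊞ j)) ⟩
    ∑[ δ < K ] ∑[ j < K ] (A j * B (δ ⊞ j))
      ≈⟨ sum-cong-≋ {K} (λ δ → sum-cong-≋ {K} (λ j → product δ j)) ⟩
    ∑[ δ < K ] ⟦ t ⊛[ δ ] t′ ⟧ᵀ x i ∎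
    where
    A B : Fin K → Carrier
    A j = weight t (j ⊞ i) * monomial (shifts t) x j
    B j = weight t′ (j ⊞ i) * monomial (shifts t′) x j
    product : ∀ δ j → A j * B (δ ⊞ j) ≈ weight (t ⊛[ δ ] t′) (j ⊞ i) * monomial (shifts (t ⊛[ δ ] t′)) x j
    product δ j = begin
      A j * (weight t′ ((δ ⊞ j) ⊞ i) * monomial (shifts t′) x (δ ⊞ j))
        ≈⟨ *-congˡ (*-cong (reflexive (≡.cong (weight t′) (⊞-assoc δ j i)))
                           (sym (monomial-rotate δ (shifts t′) x j))) ⟩
      A j * (weight t′ (δ ⊞ (j ⊞ i)) * monomial (map (_⊞ δ) (shifts t′)) x j)
        ≈⟨ *-interchange _ _ _ _ ⟩
      (weight t (j ⊞ i) * weight t′ (δ ⊞ (j ⊞ i)))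
        * (monomial (shifts t) x j * monomial (map (_⊞ δ) (shifts t′)) x j)
        ≈⟨ *-congˡ (sym (monomial-++ (shifts t) _ x j)) ⟩
      weight (t ⊛[ δ ] t′) (j ⊞ i) * monomial (shifts (t ⊛[ δ ] t′)) x j ∎

  record Summand : Set (c ⊔ ℓ) where
    field
      σ           : Cfg → Carrier
      σ-symmetric : Symmetric ℝ σ
      τ           : Term
  open Summand public

  ⟦_⟧ˢ : Summand → Cfg → Fin K → Carrier
  ⟦ s ⟧ˢ x i = σ s x * ⟦ τ s ⟧ᵀ x i

  degreeˢ : Summand → ℕ
  degreeˢ s = length (shifts (τ s))

  ∑ˢ : List Summand → Cfg → Fin K → Carrier
  ∑ˢ ss x i = ∑ᴸ (λ s → ⟦ s ⟧ˢ x i) ss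

  record Expressible (m : ℕ) (G : Cfg → Fin K → Carrier) : Set (c ⊔ ℓ) where
    field
      summands  : List Summand
      degree≤   : All (λ s → degreeˢ s ℕ.≤ m) summands
      expansion : ∀ x i → G x i ≈ ∑ˢ summands x i
  open Expressible

  Expressible-cong : ∀ {m G H} → (∀ x i → G x i ≈ H x i) → Expressible m G → Expressible m H
  Expressible-cong G≈H E = record
    { summands  = summands E
    ; degree≤   = degree≤ E
    ; expansion = λ x i → trans (sym (G≈H x i)) (expansion E x i)
    }

  Expressible-weaken : ∀ {m n G} → m ℕ.≤ n → Expressible m G → Expressible n G
  Expressible-weaken m≤n E = record
    { summands  = summands E
    ; degree≤   = All.map (λ d≤m → ℕ.≤-trans d≤m m≤n) (degree≤ E)
    ; expansion = expansion E
    }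

  Expressible-0 : ∀ {m} → Expressible m (λ _ _ → 0#)
  Expressible-0 = record { summands = [] ; degree≤ = [] ; expansion = λ _ _ → refl }

  Expressible-summand : ∀ {m} s → degreeˢ s ℕ.≤ m → Expressible m ⟦ s ⟧ˢ
  Expressible-summand s d≤m = record
    { summands = s ∷ [] ; degree≤ = d≤m ∷ [] ; expansion = λ _ _ → sym (+-identityʳ _) }

  Expressible-+ : ∀ {m G H} → Expressible m G → Expressible m H → Expressible m (λ x i → G x i + H x i)
  Expressible-+ E F = record
    { summands  = summands E ++ summands F
    ; degree≤   = ++⁺ (degree≤ E) (degree≤ F)
    ; expansion = λ x i → trans (+-cong (expansion E x i) (expansion F x i))
                                (sym (∑ᴸ-++ _ (summands E) (summands F)))
    }

  Expressible-∑ : ∀ {m} n {G : Fin n → Cfg → Fin K → Carrier} →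
                  (∀ r → Expressible m (G r)) → Expressible m (λ x i → ∑[ r < n ] G r x i)
  Expressible-∑ zero    E = Expressible-0
  Expressible-∑ (suc n) E = Expressible-+ (E Fin.zero) (Expressible-∑ n (λ r → E (Fin.suc r)))

  Expressible-∑ᴸ : ∀ {a} {A : Set a} {m} {G : A → Cfg → Fin K → Carrier} {as} →
                   All (λ a → Expressible m (G a)) as → Expressible m (λ x i → ∑ᴸ (λ a → G a x i) as)
  Expressible-∑ᴸ []       = Expressible-0
  Expressible-∑ᴸ (E ∷ Es) = Expressible-+ E (Expressible-∑ᴸ Es)

  Expressible-scale : ∀ {m G} {ρ : Cfg → Carrier} → Symmetric ℝ ρ →
                      Expressible m G → Expressible m (λ x i → ρ x * G x i)
  Expressible-scale {ρ = ρ} ρ-sym E = record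
    { summands  = map scale (summands E)
    ; degree≤   = map⁺ (degree≤ E)
    ; expansion = λ x i → trans (*-congˡ (expansion E x i)) (∑ˢ-scale x i (summands E))
    }
    where
    scale : Summand → Summand
    scale s = record { σ = λ x → ρ x * σ s x ; σ-symmetric = Symmetric-* ρ-sym (σ-symmetric s) ; τ = τ s }
    ∑ˢ-scale : ∀ x i ss → ρ x * ∑ˢ ss x i ≈ ∑ˢ (map scale ss) x i
    ∑ˢ-scale x i []       = zeroʳ _
    ∑ˢ-scale x i (s ∷ ss) = trans (distribˡ _ _ _) (+-cong (sym (*-assoc _ _ _)) (∑ˢ-scale x i ss))

  Expressible-1 : Expressible 0 (λ _ _ → 1#)
  Expressible-1 = Expressible-cong (λ x i → trans (*-identityˡ _) (∑-recip x i))
    (Expressible-summand unit ℕ.z≤n)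
    where
    unit : Summand
    unit = record { σ = λ _ → 1# ; σ-symmetric = Symmetric-const 1# ; τ = (λ _ → recip k') ⟨ [] ⟩ }
    ∑-recip : ∀ x i → ⟦ τ unit ⟧ᵀ x i ≈ 1#
    ∑-recip x i = begin
      ∑[ j < K ] (recip k' * 1#)    ≈⟨ sum-replicate K ⟩
      K × (recip k' * 1#)           ≈⟨ ×-comm-* K (recip k') 1# ⟨
      recip k' * K × 1#             ≈⟨ recip-inverseˡ k' ⟩
      1#                            ∎

  private
    Expressible-summand-* : ∀ {a b} s s′ → degreeˢ s ℕ.≤ a → degreeˢ s′ ℕ.≤ b →
                            Expressible (a ℕ.+ b) (λ x i → ⟦ s ⟧ˢ x i * ⟦ s′ ⟧ˢ x i)
    Expressible-summand-* {a} {b} s s′ d≤a d′≤b =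
      Expressible-cong expand (Expressible-∑ K (λ δ → Expressible-summand (product δ) (degreeˢ-product δ)))
      where
      product : Fin K → Summand
      product δ = record
        { σ           = λ x → σ s x * σ s′ x
        ; σ-symmetric = Symmetric-* (σ-symmetric s) (σ-symmetric s′)
        ; τ           = τ s ⊛[ δ ] τ s′
        }
      degreeˢ-product : ∀ δ → degreeˢ (product δ) ℕ.≤ a ℕ.+ b
      degreeˢ-product δ = ℕ.≤-trans
        (ℕ.≤-reflexive (≡.trans (length-++ (shifts (τ s)))
                                (≡.cong (degreeˢ s ℕ.+_) (length-map (_⊞ δ) (shifts (τ s′))))))
        (ℕ.+-mono-≤ d≤a d′≤b)
      expand : ∀ x i → ∑[ δ < K ] ⟦ product δ ⟧ˢ x i ≈ ⟦ s ⟧ˢ x i * ⟦ s′ ⟧ˢ x i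
      expand x i = begin
        ∑[ δ < K ] ((σ s x * σ s′ x) * ⟦ τ s ⊛[ δ ] τ s′ ⟧ᵀ x i)
          ≈⟨ *-distribˡ-sum (σ s x * σ s′ x) (λ δ → ⟦ τ s ⊛[ δ ] τ s′ ⟧ᵀ x i) ⟨
        (σ s x * σ s′ x) * ∑[ δ < K ] ⟦ τ s ⊛[ δ ] τ s′ ⟧ᵀ x i
          ≈⟨ *-congˡ (⟦⟧ᵀ-* (τ s) (τ s′) x i) ⟨
        (σ s x * σ s′ x) * (⟦ τ s ⟧ᵀ x i * ⟦ τ s′ ⟧ᵀ x i)
          ≈⟨ *-interchange _ _ _ _ ⟩
        ⟦ s ⟧ˢ x i * ⟦ s′ ⟧ˢ x i ∎

    Expressible-summand-∑ˢ : ∀ {a b} s ss′ → degreeˢ s ℕ.≤ a → All (λ s′ → degreeˢ s′ ℕ.≤ b) ss′ →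
                             Expressible (a ℕ.+ b) (λ x i → ⟦ s ⟧ˢ x i * ∑ˢ ss′ x i)
    Expressible-summand-∑ˢ s []         d≤a []            = Expressible-cong (λ _ _ → sym (zeroʳ _)) Expressible-0
    Expressible-summand-∑ˢ s (s′ ∷ ss′) d≤a (d′≤b ∷ ds≤b) = Expressible-cong (λ _ _ → sym (distribˡ _ _ _))
      (Expressible-+ (Expressible-summand-* s s′ d≤a d′≤b) (Expressible-summand-∑ˢ s ss′ d≤a ds≤b))

    Expressible-∑ˢ-* : ∀ {a b} ss ss′ → All (λ s → degreeˢ s ℕ.≤ a) ss → All (λ s′ → degreeˢ s′ ℕ.≤ b) ss′ →
                       Expressible (a ℕ.+ b) (λ x i → ∑ˢ ss x i * ∑ˢ ss′ x i)
    Expressible-∑ˢ-* []       ss′ []            _     = Expressible-cong (λ _ _ → sym (zeroˡ _)) Expressible-0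
    Expressible-∑ˢ-* (s ∷ ss) ss′ (d≤a ∷ ds≤a) ds′≤b = Expressible-cong (λ _ _ → sym (distribʳ _ _ _))
      (Expressible-+ (Expressible-summand-∑ˢ s ss′ d≤a ds′≤b) (Expressible-∑ˢ-* ss ss′ ds≤a ds′≤b))

  Expressible-* : ∀ {a b G H} → Expressible a G → Expressible b H →
                  Expressible (a ℕ.+ b) (λ x i → G x i * H x i)
  Expressible-* E F = Expressible-cong (λ x i → sym (*-cong (expansion E x i) (expansion F x i)))
    (Expressible-∑ˢ-* (summands E) (summands F) (degree≤ E) (degree≤ F))

  Expressible-linear : ∀ as ds (ψ : Fin K → Carrier) →
    Expressible (length ds ℕ.+ length as)
                (λ x i → ∑[ j < K ] (ψ (j ⊞ i) * (monomial ds x j * ∏⁺ as (val ℝ x j))))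
  Expressible-linear []       ds ψ = Expressible-cong
    (λ x i → trans (*-identityˡ _) (sum-cong-≋ {K} (λ j → *-congˡ {ψ (j ⊞ i)} (sym (*-identityʳ (monomial ds x j))))))
    (Expressible-summand (record { σ = λ _ → 1# ; σ-symmetric = Symmetric-const 1# ; τ = ψ ⟨ ds ⟩ })
                         (ℕ.≤-reflexive (≡.sym (ℕ.+-identityʳ (length ds)))))
  Expressible-linear (a ∷ as) ds ψ = Expressible-cong
    (λ x i → trans (sym (∑-distrib-+ (λ j → ψ (j ⊞ i) * (monomial (Fin.zero ∷ ds) x j * ∏⁺ as (val ℝ x j)))
                                     (λ j → a * ψ (j ⊞ i) * (monomial ds x j * ∏⁺ as (val ℝ x j)))))
                   (sum-cong-≋ {K} (split x i)))
    (Expressible-+ (Expressible-weaken (ℕ.≤-reflexive (≡.sym (ℕ.+-suc (length ds) (length as))))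
                                       (Expressible-linear as (Fin.zero ∷ ds) ψ))
                   (Expressible-weaken (ℕ.+-monoʳ-≤ (length ds) (ℕ.n≤1+n (length as)))
                                       (Expressible-linear as ds (λ u → a * ψ u))))
    where
    split : ∀ x i j → ψ (j ⊞ i) * (monomial (Fin.zero ∷ ds) x j * ∏⁺ as (val ℝ x j))
                      + a * ψ (j ⊞ i) * (monomial ds x j * ∏⁺ as (val ℝ x j))
                    ≈ ψ (j ⊞ i) * (monomial ds x j * ∏⁺ (a ∷ as) (val ℝ x j))
    split x i j = begin
      w * (val ℝ x (Fin.zero ⊞ j) * M * Π) + a * w * (M * Π)
        ≡⟨ ≡.cong (λ k → w * (val ℝ x k * M * Π) + a * w * (M * Π)) (⊞-identityˡ j) ⟩
      w * (v * M * Π) + a * w * (M * Π)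
        ≈⟨ solve 5 (λ w v M Π a → w :* (v :* M :* Π) :+ a :* w :* (M :* Π) := w :* (M :* ((v :+ a) :* Π)))
                   refl w v M Π a ⟩
      w * (M * ((v + a) * Π)) ∎
      where
      w v M Π : Carrier
      w = ψ (j ⊞ i)
      v = val ℝ x j
      M = monomial ds x j
      Π = ∏⁺ as (val ℝ x j)

  ∑-⟦⟧ᵀ : ∀ t x → ∑[ i < K ] ⟦ t ⟧ᵀ x i ≈ ∑[ u < K ] weight t u * ∑[ j < K ] monomial (shifts t) x j
  ∑-⟦⟧ᵀ t x = begin
    ∑[ i < K ] ∑[ j < K ] (weight t (j ⊞ i) * monomial (shifts t) x j)
      ≈⟨ ∑-comm (λ i j → weight t (j ⊞ i) * monomial (shifts t) x j) ⟩
    ∑[ j < K ] ∑[ i < K ] (weight t (j ⊞ i) * monomial (shifts t) x j)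
      ≈⟨ sum-cong-≋ {K} (λ j → *-distribʳ-sum (monomial (shifts t) x j) (λ i → weight t (j ⊞ i))) ⟨
    ∑[ j < K ] (∑[ i < K ] weight t (j ⊞ i) * monomial (shifts t) x j)
      ≈⟨ sum-cong-≋ {K} (λ j → *-congʳ {monomial (shifts t) x j} (∑-weight j)) ⟩
    ∑[ j < K ] (∑[ u < K ] weight t u * monomial (shifts t) x j)
      ≈⟨ *-distribˡ-sum (sum (weight t)) (λ j → monomial (shifts t) x j) ⟨
    ∑[ u < K ] weight t u * ∑[ j < K ] monomial (shifts t) x j ∎
    where
    ∑-weight : ∀ j → ∑[ i < K ] weight t (j ⊞ i) ≈ ∑[ u < K ] weight t u
    ∑-weight j =
      trans (sum-cong-≋ {K} (λ i → reflexive (≡.cong (weight t) (⊞-comm j i)))) (∑-rotate j (weight t))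

  record Part (m : ℕ) : Set (c ⊔ ℓ) where
    field
      ρ           : Cfg → Carrier
      ρ-symmetric : Symmetric ℝ ρ
      spec        : TSpec K m
  open Part public

  ⟦_⟧ᴾ : ∀ {m} → Part m → Cfg → Carrier
  ⟦ q ⟧ᴾ x = ρ q x * evalT ℝ (spec q) x

  private
    ∏-lookup : ∀ ds x j → ∏ ℝ (length ds) (λ t → val ℝ x (lookup ds t ⊞ j)) ≡ monomial ds x j
    ∏-lookup []       x j = ≡.refl
    ∏-lookup (d ∷ ds) x j = ≡.cong (val ℝ x (d ⊞ j) *_) (∏-lookup ds x j)

  cyclicStat≈∑monomial : ∀ ds x → cyclicStat ℝ (length ds) (lookup ds) x ≈ ∑[ j < K ] monomial ds x j
  cyclicStat≈∑monomial ds x = reflexive (≡.trans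
    (∑≡sum K (λ j → ∏ ℝ (length ds) (λ t → val ℝ x (lookup ds t ⊞ j))))
    (sum-cong-≗ {K} (∏-lookup ds x)))

  toPart : ∀ {m} {σ : Cfg → Carrier} → Symmetric ℝ σ → (w : Fin K → Carrier) (ds : List (Fin K)) →
           length ds ℕ.≤ m → Part m
  toPart {σ = σ} σ-sym w []       _   = record
    { ρ           = λ x → σ x * (sum w * ∑[ j < K ] 1#)
    ; ρ-symmetric = Symmetric-* σ-sym (Symmetric-const _)
    ; spec        = one
    }
  toPart {σ = σ} σ-sym w (d ∷ ds) l≤m = record
    { ρ           = λ x → σ x * sum w
    ; ρ-symmetric = Symmetric-* σ-sym (Symmetric-const _)
    ; spec        = cyc (length (d ∷ ds)) (ℕ.s≤s ℕ.z≤n) l≤m (lookup (d ∷ ds))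
    }

  toPart-correct : ∀ {m} {σ : Cfg → Carrier} (σ-sym : Symmetric ℝ σ) w ds (l≤m : length ds ℕ.≤ m) x →
                   σ x * (sum w * ∑[ j < K ] monomial ds x j) ≈ ⟦ toPart σ-sym w ds l≤m ⟧ᴾ x
  toPart-correct σ-sym w []       _   x = sym (*-identityʳ _)
  toPart-correct σ-sym w (d ∷ ds) l≤m x =
    trans (sym (*-assoc _ _ _)) (*-congˡ (sym (cyclicStat≈∑monomial (d ∷ ds) x)))

  cyclicDecomposition : ∀ {m G} → Expressible m G →
                        Σ (List (Part m)) λ qs → ∀ x → ∑[ i < K ] G x i ≈ ∑ᴸ (λ q → ⟦ q ⟧ᴾ x) qs
  cyclicDecomposition E = parts (summands E) (degree≤ E) ,
    λ x → trans (sum-cong-≋ {K} (expansion E x)) (parts-correct (summands E) (degree≤ E) x)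
    where
    parts : ∀ {m} ss → All (λ s → degreeˢ s ℕ.≤ m) ss → List (Part m)
    parts []       []          = []
    parts (s ∷ ss) (d≤m ∷ ds≤m) = toPart (σ-symmetric s) (weight (τ s)) (shifts (τ s)) d≤m ∷ parts ss ds≤m
    parts-correct : ∀ {m} ss (ds≤m : All (λ s → degreeˢ s ℕ.≤ m) ss) x →
                    ∑[ i < K ] ∑ˢ ss x i ≈ ∑ᴸ (λ q → ⟦ q ⟧ᴾ x) (parts ss ds≤m)
    parts-correct []       []          x = sum-replicate-zero K
    parts-correct (s ∷ ss) (d≤m ∷ ds≤m) x = begin
      ∑[ i < K ] (⟦ s ⟧ˢ x i + ∑ˢ ss x i)
        ≈⟨ ∑-distrib-+ (⟦ s ⟧ˢ x) (∑ˢ ss x) ⟩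
      ∑[ i < K ] (σ s x * ⟦ τ s ⟧ᵀ x i) + ∑[ i < K ] ∑ˢ ss x i
        ≈⟨ +-congʳ (*-distribˡ-sum (σ s x) (⟦ τ s ⟧ᵀ x)) ⟨
      σ s x * ∑[ i < K ] ⟦ τ s ⟧ᵀ x i + ∑[ i < K ] ∑ˢ ss x i
        ≈⟨ +-cong (trans (*-congˡ (∑-⟦⟧ᵀ (τ s) x)) (toPart-correct (σ-symmetric s) (weight (τ s)) (shifts (τ s)) d≤m x))
                  (parts-correct ss ds≤m x) ⟩
      ∑ᴸ (λ q → ⟦ q ⟧ᴾ x) (parts (s ∷ ss) (d≤m ∷ ds≤m)) ∎

module RootStatistics {c ℓ : Level} (ℝ : RealField c ℓ) (k' xs : ℕ) (b : Fin (suc k') → RealField.Carrier ℝ) where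
  open RealField ℝ
  open import Algebra.Properties.Semiring.Exp semiring using (_^_)
  open import Algebra.Properties.Semiring.Mult semiring using (_×_)
  open import Algebra.Properties.Semiring.Sum semiring using (sum-syntax; sum-cong-≋; ∑-distrib-+)
  open import Data.List using (List; []; _∷_; map; downFrom; applyDownFrom)
  open import Data.List.Properties using (map-applyDownFrom; length-applyDownFrom)
  import Data.List.Relation.Unary.All as All
  open import Data.Fin using (toℕ)
  open import Data.Fin.Properties using (toℕ<n)
  open CyclicIndex k'
  open ListSums commutativeSemiring
  open ElementarySymmetric commRing using (e; powerSum; e′-∸; newtonTerm; newton)
  open import Data.Nat.Induction using (<-rec)
  open FallingFactorials commRing
  open RealFacts ℝ using (fromℕ≡×; recip; recip-unique)
  open Polynomials ℝ using (rootBlock; roots)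
  open CyclicTerms ℝ k' xs
  open RingSolver commRing using (solve; _:=_; _:+_; _:*_; :-_; _:-_; con)
  open import Data.Integer using (1ℤ)
  open import Relation.Binary.Reasoning.Setoid setoid

  private
    K : ℕ
    K = suc k'

  values : ℕ → List Carrier
  values a = applyDownFrom (λ t → fromℕ ℝ (a ℕ.+ suc t)) (xs ℕ.∸ a)

  S : ℕ → ℕ → Carrier
  S e a = ∑ᴸ (ff e) (values a)

  S-telescope : ∀ e a → a ℕ.≤ xs →
                S e a ≈ recip e * (ff (suc e) (fromℕ ℝ (suc xs)) - ∏⁺ (1# ∷ fallingShifts e) (fromℕ ℝ a))
  S-telescope e a a≤xs = begin
    ∑ᴸ (ff e) (applyDownFrom (λ t → fromℕ ℝ (a ℕ.+ suc t)) n)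
      ≡⟨ ≡.cong (∑ᴸ (ff e)) (map-applyDownFrom (λ t → t) _ n) ⟨
    ∑ᴸ (ff e) (map (λ t → fromℕ ℝ (a ℕ.+ suc t)) (downFrom n))
      ≡⟨ ∑ᴸ-map (ff e) _ (downFrom n) ⟩
    ∑ᴸ (λ t → ff e (fromℕ ℝ (a ℕ.+ suc t))) (downFrom n)
      ≈⟨ ∑ᴸ-cong (λ t → reflexive (≡.cong (ff e) (value≡ t))) (downFrom n) ⟩
    ∑ᴸ (λ t → ff e ((t ℕ.+ suc a) × 1#)) (downFrom n)
      ≈⟨ recip-unique e (telescope e (suc a) n) ⟩
    recip e * (ff (suc e) ((n ℕ.+ suc a) × 1#) - ff (suc e) (suc a × 1#))
      ≈⟨ *-congˡ (+-cong (reflexive top) (-‿cong bottom)) ⟩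
    recip e * (ff (suc e) (fromℕ ℝ (suc xs)) - ∏⁺ (1# ∷ fallingShifts e) (fromℕ ℝ a)) ∎
    where
    n : ℕ
    n = xs ℕ.∸ a
    value≡ : ∀ t → fromℕ ℝ (a ℕ.+ suc t) ≡ (t ℕ.+ suc a) × 1#
    value≡ t = ≡.trans (fromℕ≡× (a ℕ.+ suc t))
                       (≡.cong (_× 1#) (≡.trans (ℕ.+-comm a (suc t)) (≡.sym (ℕ.+-suc t a))))
    top : ff (suc e) ((n ℕ.+ suc a) × 1#) ≡ ff (suc e) (fromℕ ℝ (suc xs))
    top = ≡.trans (≡.cong (λ k → ff (suc e) (k × 1#)) (≡.trans (ℕ.+-suc n a) (≡.cong suc (ℕ.m∸n+n≡m a≤xs))))
                  (≡.cong (ff (suc e)) (≡.sym (fromℕ≡× (suc xs))))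
    bottom : ff (suc e) (suc a × 1#) ≈ ∏⁺ (1# ∷ fallingShifts e) (fromℕ ℝ a)
    bottom = trans (ff-suc-1+ e (a × 1#)) (reflexive (≡.cong (∏⁺ (1# ∷ fallingShifts e)) (≡.sym (fromℕ≡× a))))

  powerSum-rootBlock : ∀ r β a →
    ∑ᴸ (_^ r) (rootBlock xs β a) ≈ S r a + ∑ᴸ (λ u → coefficient u β * S (degree u) a) (lowerFF r)
  powerSum-rootBlock r β a = begin
    ∑ᴸ (_^ r) (rootBlock xs β a)
      ≡⟨ ≡.cong (∑ᴸ (_^ r)) (map-applyDownFrom _ (λ y → - β + y) (xs ℕ.∸ a)) ⟨
    ∑ᴸ (_^ r) (map (λ y → - β + y) (values a))
      ≡⟨ ∑ᴸ-map (_^ r) (λ y → - β + y) (values a) ⟩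
    ∑ᴸ (λ y → (- β + y) ^ r) (values a)
      ≈⟨ powerSum-ff r β (values a) ⟩
    S r a + ∑ᴸ (λ u → coefficient u β * S (degree u) a) (lowerFF r) ∎

  lowerSum : FFTerm → Cfg → Fin K → Carrier
  lowerSum u x i = ∑[ j < K ] (coefficient u (b (j ⊞ i)) * S (degree u) (toℕ (x j)))

  Expressible-lowerSum : ∀ u → Expressible (suc (degree u)) (lowerSum u)
  Expressible-lowerSum u = Expressible-cong
    (λ x i → trans (sym (∑-distrib-+ (λ j → ψ₁ (j ⊞ i) * (1# * 1#))
                                     (λ j → ψ₂ (j ⊞ i) * (1# * ∏⁺ (1# ∷ fallingShifts d) (val ℝ x j)))))
                   (sum-cong-≋ {K} (combine x i)))
    (Expressible-+ (Expressible-weaken ℕ.z≤n (Expressible-linear [] [] ψ₁))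
                   (Expressible-weaken (ℕ.≤-reflexive (≡.cong suc (length-applyDownFrom _ d)))
                                       (Expressible-linear (1# ∷ fallingShifts d) [] ψ₂)))
    where
    d : ℕ
    d = degree u
    C : Carrier
    C = ff (suc d) (fromℕ ℝ (suc xs))
    ψ₁ ψ₂ : Fin K → Carrier
    ψ₁ v = coefficient u (b v) * recip d * C
    ψ₂ v = - (coefficient u (b v) * recip d)
    combine : ∀ x i j → ψ₁ (j ⊞ i) * (1# * 1#) + ψ₂ (j ⊞ i) * (1# * ∏⁺ (1# ∷ fallingShifts d) (val ℝ x j))
                        ≈ coefficient u (b (j ⊞ i)) * S d (toℕ (x j))
    combine x i j = begin
      ψ₁ (j ⊞ i) * (1# * 1#) + ψ₂ (j ⊞ i) * (1# * F)
        ≈⟨ solve 4 (λ G I C F → G :* I :* C :* (con 1ℤ :* con 1ℤ) :+ (:- (G :* I)) :* (con 1ℤ :* F)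
                                  := G :* (I :* (C :- F)))
                   refl (coefficient u (b (j ⊞ i))) (recip d) C F ⟩
      coefficient u (b (j ⊞ i)) * (recip d * (C - F))
        ≈⟨ *-congˡ (sym (S-telescope d (toℕ (x j)) (ℕ.≤-pred (toℕ<n (x j))))) ⟩
      coefficient u (b (j ⊞ i)) * S d (toℕ (x j)) ∎
      where
      F : Carrier
      F = ∏⁺ (1# ∷ fallingShifts d) (val ℝ x j)

  powerSum-expressible : ∀ r → Expressible r (λ x i → powerSum (roots xs b x i) r)
  powerSum-expressible r = Expressible-cong (λ x i → sym (powerSum-roots x i))
    (Expressible-+ (Expressible-weaken ℕ.z≤n (Expressible-cong (λ _ _ → *-identityʳ _)
                      (Expressible-scale (Symmetric-∑ (λ a → S r (toℕ a))) Expressible-1)))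
                   (Expressible-∑ᴸ (All.map (λ {u} deg<r → Expressible-weaken deg<r (Expressible-lowerSum u))
                                            (lowerFF-degree r))))
    where
    powerSum-roots : ∀ x i → powerSum (roots xs b x i) r
                             ≈ ∑[ j < K ] S r (toℕ (x j)) + ∑ᴸ (λ u → lowerSum u x i) (lowerFF r)
    powerSum-roots x i = begin
      powerSum (roots xs b x i) r
        ≈⟨ ∑ᴸ-concat-tabulate (_^ r) (λ j → rootBlock xs (b (j ⊞ i)) (toℕ (x j))) ⟩
      ∑[ j < K ] ∑ᴸ (_^ r) (rootBlock xs (b (j ⊞ i)) (toℕ (x j)))
        ≈⟨ sum-cong-≋ {K} (λ j → powerSum-rootBlock r (b (j ⊞ i)) (toℕ (x j))) ⟩
      ∑[ j < K ] (S r (toℕ (x j)) + ∑ᴸ (T j) (lowerFF r))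
        ≈⟨ ∑-distrib-+ (λ j → S r (toℕ (x j))) (λ j → ∑ᴸ (T j) (lowerFF r)) ⟩
      ∑[ j < K ] S r (toℕ (x j)) + ∑[ j < K ] ∑ᴸ (T j) (lowerFF r)
        ≈⟨ +-congˡ (∑-∑ᴸ-comm T (lowerFF r)) ⟩
      ∑[ j < K ] S r (toℕ (x j)) + ∑ᴸ (λ u → lowerSum u x i) (lowerFF r) ∎
      where
      T : Fin K → FFTerm → Carrier
      T j u = coefficient u (b (j ⊞ i)) * S (degree u) (toℕ (x j))

  e-expressible : ∀ m → Expressible m (λ x i → e (roots xs b x i) m)
  e-expressible = <-rec _ step
    where
    step : ∀ m → (∀ {n} → n ℕ.< m → Expressible n (λ x i → e (roots xs b x i) n)) →
           Expressible m (λ x i → e (roots xs b x i) m)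
    step zero    _   = Expressible-1
    step (suc m) rec = Expressible-cong (λ x i → sym (recip-unique m (newton (roots xs b x i) (suc m))))
      (Expressible-scale (Symmetric-const (recip m)) (Expressible-∑ (suc m) term))
      where
      term : ∀ r → Expressible (suc m) (λ x i → newtonTerm (roots xs b x i) (suc m) (toℕ r))
      term r = Expressible-cong (λ x i → *-congˡ (*-congʳ (reflexive (≡.sym (e′-∸ (roots xs b x i) r≤m)))))
        (Expressible-scale (Symmetric-const ((- 1#) ^ toℕ r))
          (Expressible-weaken (ℕ.≤-reflexive degree≡)
            (Expressible-* (rec (ℕ.s≤s (ℕ.m∸n≤m m (toℕ r)))) (powerSum-expressible (suc (toℕ r))))))
        where
        r≤m : toℕ r ℕ.≤ m
        r≤m = ℕ.≤-pred (toℕ<n r)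
        degree≡ : m ℕ.∸ toℕ r ℕ.+ suc (toℕ r) ≡ suc m
        degree≡ = ≡.trans (ℕ.+-suc (m ℕ.∸ toℕ r) (toℕ r)) (≡.cong suc (ℕ.m∸n+n≡m r≤m))

open import Data.List using (length; lookup)
open import Data.Product using (Σ; _×_; _,_)

lemma5p2 : {c ℓ : Level} (ℝ : RealField c ℓ) (k' xs : ℕ) →
    let open RealField ℝ
        k = suc k'
    in (b : Fin k → Carrier) (m : ℕ) →
       Σ ℕ λ R →
       Σ (Fin R → Config ℝ k xs → Carrier) λ σ →
       Σ (Fin R → TSpec k m) λ T →
         (∀ r → Symmetric ℝ (σ r)) ×
         (∀ (x : Config ℝ k xs) →
            coeffDown ℝ (P ℝ k xs b x) (L ℝ k xs x) m
              ≈ ∑ ℝ R (λ r → σ r x * evalT ℝ (T r) x))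
lemma5p2 ℝ k' xs b m with CyclicTerms.cyclicDecomposition ℝ k' xs (RootStatistics.e-expressible ℝ k' xs b m)
... | parts , decomposes =
  length parts , (λ r → ρ (lookup parts r)) , (λ r → spec (lookup parts r)) ,
  (λ r → ρ-symmetric (lookup parts r)) ,
  λ x → begin
    coeffDown ℝ (P ℝ (suc k') xs b x) (L ℝ (suc k') xs x) m    ≈⟨ coeffDown-P xs b x m ⟩
    ∑[ i < suc k' ] e (roots xs b x i) m                       ≈⟨ decomposes x ⟩
    ∑ᴸ (λ q → ⟦ q ⟧ᴾ x) parts                                  ≡⟨ ∑ᴸ≡sum-lookup (λ q → ⟦ q ⟧ᴾ x) parts ⟩
    ∑[ r < length parts ] ⟦ lookup parts r ⟧ᴾ x                ≡⟨ ∑≡sum (length parts) _ ⟨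
    ∑ ℝ (length parts) (λ r → ⟦ lookup parts r ⟧ᴾ x)           ∎
  where
  open RealField ℝ
  open import Algebra.Properties.Semiring.Sum semiring using (sum-syntax)
  open import Relation.Binary.Reasoning.Setoid setoid
  open ListSums commutativeSemiring using (∑ᴸ; ∑ᴸ≡sum-lookup)
  open ElementarySymmetric commRing using (e)
  open RealFacts ℝ using (∑≡sum)
  open Polynomials ℝ using (roots; coeffDown-P)
  open CyclicTerms ℝ k' xs using (ρ; ρ-symmetric; spec; ⟦_⟧ᴾ)
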